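{- Let $\{G_k(x)\}_{k\ge 0}$ be a generalized Fibonacci polynomial sequence which is either of Fibonacci type or of Lucas type. Then $\gcd(G_m(x),G_n(x))=G_{\gcd(m,n)}(x)$ holds for any two positive integers $m$ and $n$ if and only if $\{G_k(x)\}$ is of Fibonacci type.
   Context: All polynomials lie in $\mathbb{Z}[x]$ and $\gcd$ denotes the greatest common divisor in $\mathbb{Z}[x]$ (determined up to sign). A generalized Fibonacci polynomial (GFP) sequence $\{G_n(x)\}_{n\ge0}$ is given by $G_0(x)=p_0(x)$, $G_1(x)=p_1(x)$ and $G_n(x)=d(x)G_{n-1}(x)+g(x)G_{n-2}(x)$ for $n\ge 2$, where $p_0(x)$ is a constant and $p_1(x),d(x),g(x)$ are nonzero polynomials in $\mathbb{Z}[x]$ with $\gcd(d(x),g(x))=1$; as in the paper it is assumed that $d(x)^2+4g(x)>0$. Let $a=a(x)$, $b=b(x)$ be the roots of $z^2-d(x)z-g(x)=0$ (so $a+b=d$, $ab=-g$, $(a-b)^2=d^2+4g$). The sequence is of Lucas type if $p_0\ne 0$, $2p_1(x)=p_0\,d(x)$, $|p_0|\in\{1,2\}$, and $\gcd(p_0,p_1(x))=\gcd(p_0,d(x))=\gcd(p_0,g(x))=1$; then, with $\alpha=2/p_0$, $G_n=(a^n+b^n)/\alpha$. The sequence is of Fibonacci type if $p_0=0$ and $p_1=1$; then $G_n=(a^n-b^n)/(a-b)$. -}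

module Defs where

open import Data.Nat as ℕ using (ℕ; zero; suc)
open import Data.Integer as ℤ using (ℤ; 0ℤ; 1ℤ)
open import Data.List using (List; []; _∷_; map)
open import Data.Product using (Σ; ∃; _×_; _,_)
open import Data.Sum using (_⊎_)
open import Relation.Binary.PropositionalEquality using (_≡_; _≢_)

-- Polynomials in ℤ[x], as coefficient lists (constant term first).
-- Two lists denote the same polynomial iff all coefficients agree
-- (trailing zeros are irrelevant).

Poly : Set
Poly = List ℤ

coeff : Poly → ℕ → ℤ
coeff []       _       = 0ℤ
coeff (a ∷ p)  zero    = a
coeff (a ∷ p)  (suc i) = coeff p i

infix 4 _≈_
_≈_ : Poly → Poly → Set
p ≈ q = ∀ i → coeff p i ≡ coeff q i

const : ℤ → Poly
const c = c ∷ []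

X : Poly
X = 0ℤ ∷ 1ℤ ∷ []

infixl 6 _⊕_
_⊕_ : Poly → Poly → Poly
[]      ⊕ q       = q
(a ∷ p) ⊕ []      = a ∷ p
(a ∷ p) ⊕ (b ∷ q) = (a ℤ.+ b) ∷ (p ⊕ q)

scale : ℤ → Poly → Poly
scale c p = map (c ℤ.*_) p

infixl 7 _⊛_
_⊛_ : Poly → Poly → Poly
[]      ⊛ q = []
(a ∷ p) ⊛ q = scale a q ⊕ (0ℤ ∷ (p ⊛ q))

eval : Poly → ℤ → ℤ
eval []      x = 0ℤ
eval (a ∷ p) x = a ℤ.+ x ℤ.* eval p x

NonZeroPoly : Poly → Set
NonZeroPoly p = ∃ λ i → coeff p i ≢ 0ℤ

-- Divisibility and gcd in ℤ[x] (gcd determined up to a unit, i.e. sign)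

infix 4 _∣ₚ_
_∣ₚ_ : Poly → Poly → Set
p ∣ₚ q = ∃ λ r → p ⊛ r ≈ q

IsGCD : Poly → Poly → Poly → Set
IsGCD p q h = (h ∣ₚ p) × (h ∣ₚ q) × (∀ c → c ∣ₚ p → c ∣ₚ q → c ∣ₚ h)

CoprimeP : Poly → Poly → Set
CoprimeP p q = IsGCD p q (const 1ℤ)

GFP : (p0 : ℤ) (p1 d g : Poly) → ℕ → Poly
GFP p0 p1 d g zero          = const p0
GFP p0 p1 d g (suc zero)    = p1
GFP p0 p1 d g (suc (suc n)) =
  d ⊛ GFP p0 p1 d g (suc n) ⊕ g ⊛ GFP p0 p1 d g n

record GFPData (p0 : ℤ) (p1 d g : Poly) : Set where
  field
    p1≢0    : NonZeroPoly p1
    d≢0     : NonZeroPoly d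
    g≢0     : NonZeroPoly g
    coprime : CoprimeP d g
    -- d(x)^2 + 4 g(x) > 0 (read as: positive at every integer x)
    discr>0 : ∀ (x : ℤ) → 0ℤ ℤ.< eval (d ⊛ d ⊕ scale (ℤ.+ 4) g) x

FibonacciType : (p0 : ℤ) (p1 d g : Poly) → Set
FibonacciType p0 p1 d g = (p0 ≡ 0ℤ) × (p1 ≈ const 1ℤ)

LucasType : (p0 : ℤ) (p1 d g : Poly) → Set
LucasType p0 p1 d g =
  (p0 ≢ 0ℤ) ×
  (scale (ℤ.+ 2) p1 ≈ scale p0 d) ×
  ((ℤ.∣ p0 ∣ ≡ 1) ⊎ (ℤ.∣ p0 ∣ ≡ 2)) ×
  CoprimeP (const p0) p1 ×
  CoprimeP (const p0) d ×
  CoprimeP (const p0) g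

-- For a Fibonacci-type sequence the gcd property follows, as for the Fibonacci numbers, from the
-- addition formula G(m+n+1) = G(m+1)·G(n+1) + g·G(m)·G(n) and the coprimality of consecutive terms
-- (G(n+1) ≡ dⁿ mod g, and gcd(d, g) = 1). Since ℤ[x] is not a principal ideal domain, the step
-- "c ∣ G(a+1)·G(b) and gcd(c, G(a+1)) = 1 imply c ∣ G(b)" needs Euclid's lemma in ℤ[x]. It comes from a
-- Bézout identity u·a + v·b = K with K a nonzero integer (the Euclidean algorithm with pseudo-division),
-- after removing the prime factors of K one at a time with Gauss's lemma.
-- For a Lucas-type sequence the property cannot hold for both (m, n) = (1, 2) and (2, 4): G₁ ∣ G₂ and G₂ ∣ G₄,
-- together with 2·p1 = p0·d and |p0| ∈ {1, 2}, force g to be a constant, and the discriminant condition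
-- at x = 0 leaves no value compatible with g ≠ 0 and gcd(d, g) = 1.

module Submission where

open import Defs
open import Data.Nat using (ℕ; _<_)
open import Data.Nat.GCD using (gcd)
open import Data.Integer using (ℤ)
open import Data.Sum using (_⊎_)
open import Data.Product using (_×_)

open import Algebra.Bundles using (CommutativeRing)
open import Data.Empty using (⊥; ⊥-elim)
open import Data.Integer as ℤ using (0ℤ; 1ℤ; +_; -_; +[1+_]; -[1+_])
import Data.Integer.Properties as ℤP
import Data.Integer.Divisibility.Signed as SD
open import Data.Integer.Tactic.RingSolver as ℤ-Solver using ()
open import Data.List using ([]; _∷_; length)
open import Data.List.Relation.Unary.All using (_∷_)
open import Data.Maybe using (Maybe; just; nothing)
open import Data.Nat as ℕ using (zero; suc; _≤_; z≤n; s≤s; _∸_)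
import Data.Nat.Properties as ℕP
import Data.Nat.Divisibility as ℕD
open import Data.Nat.GCD using (gcd-GCD; module Bézout; gcd[m,n]∣m; gcd[m,n]∣n)
open import Data.Nat.ListAction using (product)
open import Data.Nat.Primality using (Prime; euclidsLemma; prime⇒nonTrivial; prime[2])
open import Data.Nat.Primality.Factorisation using (factorise; PrimeFactorisation)
open import Data.Product using (∃; ∃₂; _,_; proj₁; proj₂)
open import Data.Sum using (inj₁; inj₂; [_,_]′)
open import Function using (id)
open import Relation.Nullary using (¬_; Dec; yes; no)
open import Relation.Binary.PropositionalEquality
open import Tactic.RingSolver.Core.AlmostCommutativeRing using (AlmostCommutativeRing; fromCommutativeRing)
import Tactic.RingSolver as Solver

-- The ring ℤ[x]

-- Coefficientwise equality wrapped in a record, so that unification still sees both polynomials.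
infix 4 _≋_
record _≋_ (p q : Poly) : Set where
  constructor coeffwise
  field coeff-≡ : p ≈ q
open _≋_ public

≋-refl : ∀ {p} → p ≋ p
≋-refl = coeffwise λ _ → refl

≋-sym : ∀ {p q} → p ≋ q → q ≋ p
≋-sym e = coeffwise λ i → sym (coeff-≡ e i)

infixr 5 _⟫_
_⟫_ : ∀ {p q r} → p ≋ q → q ≋ r → p ≋ r
e ⟫ f = coeffwise λ i → trans (coeff-≡ e i) (coeff-≡ f i)

const-≋ : ∀ {a b} → a ≡ b → const a ≋ const b
const-≋ refl = ≋-refl

coeff-⊕ : ∀ p q i → coeff (p ⊕ q) i ≡ coeff p i ℤ.+ coeff q i
coeff-⊕ []      q       i       = sym (ℤP.+-identityˡ _)
coeff-⊕ (a ∷ p) []      i       = sym (ℤP.+-identityʳ _)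
coeff-⊕ (a ∷ p) (b ∷ q) zero    = refl
coeff-⊕ (a ∷ p) (b ∷ q) (suc i) = coeff-⊕ p q i

coeff-scale : ∀ c p i → coeff (scale c p) i ≡ c ℤ.* coeff p i
coeff-scale c []      i       = sym (ℤP.*-zeroʳ c)
coeff-scale c (a ∷ p) zero    = refl
coeff-scale c (a ∷ p) (suc i) = coeff-scale c p i

coeff-∷-⊛ : ∀ a p q i → coeff ((a ∷ p) ⊛ q) i ≡ a ℤ.* coeff q i ℤ.+ coeff (0ℤ ∷ p ⊛ q) i
coeff-∷-⊛ a p q i = trans (coeff-⊕ (scale a q) _ i) (cong (ℤ._+ _) (coeff-scale a q i))

∷-cong : ∀ a {p q} → p ≋ q → a ∷ p ≋ a ∷ q
∷-cong a e = coeffwise λ { zero → refl ; (suc i) → coeff-≡ e i }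

⊕-cong : ∀ {p p′ q q′} → p ≋ p′ → q ≋ q′ → p ⊕ q ≋ p′ ⊕ q′
⊕-cong {p} {p′} {q} {q′} e f = coeffwise λ i →
  trans (coeff-⊕ p q i) (trans (cong₂ ℤ._+_ (coeff-≡ e i) (coeff-≡ f i)) (sym (coeff-⊕ p′ q′ i)))

scale-cong : ∀ c {p q} → p ≋ q → scale c p ≋ scale c q
scale-cong c {p} {q} e = coeffwise λ i →
  trans (coeff-scale c p i) (trans (cong (c ℤ.*_) (coeff-≡ e i)) (sym (coeff-scale c q i)))

⊕-comm : ∀ p q → p ⊕ q ≋ q ⊕ p
⊕-comm p q = coeffwise λ i →
  trans (coeff-⊕ p q i) (trans (ℤP.+-comm (coeff p i) _) (sym (coeff-⊕ q p i)))

⊕-assoc : ∀ p q r → (p ⊕ q) ⊕ r ≋ p ⊕ (q ⊕ r)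
⊕-assoc p q r = coeffwise λ i → begin
  coeff ((p ⊕ q) ⊕ r) i                      ≡⟨ coeff-⊕ (p ⊕ q) r i ⟩
  coeff (p ⊕ q) i ℤ.+ coeff r i               ≡⟨ cong (ℤ._+ coeff r i) (coeff-⊕ p q i) ⟩
  (coeff p i ℤ.+ coeff q i) ℤ.+ coeff r i     ≡⟨ ℤP.+-assoc (coeff p i) _ _ ⟩
  coeff p i ℤ.+ (coeff q i ℤ.+ coeff r i)     ≡⟨ cong (ℤ._+_ (coeff p i)) (coeff-⊕ q r i) ⟨
  coeff p i ℤ.+ coeff (q ⊕ r) i               ≡⟨ coeff-⊕ p (q ⊕ r) i ⟨
  coeff (p ⊕ (q ⊕ r)) i                      ∎
  where open ≡-Reasoning

⊕-identityʳ : ∀ p → p ⊕ [] ≋ p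
⊕-identityʳ p = coeffwise λ i → trans (coeff-⊕ p [] i) (ℤP.+-identityʳ _)

⊕-interchange : ∀ p q r s → (p ⊕ q) ⊕ (r ⊕ s) ≋ (p ⊕ r) ⊕ (q ⊕ s)
⊕-interchange p q r s = coeffwise λ i → begin
  coeff ((p ⊕ q) ⊕ (r ⊕ s)) i
    ≡⟨ trans (coeff-⊕ (p ⊕ q) _ i) (cong₂ ℤ._+_ (coeff-⊕ p q i) (coeff-⊕ r s i)) ⟩
  (coeff p i ℤ.+ coeff q i) ℤ.+ (coeff r i ℤ.+ coeff s i)
    ≡⟨ interchange (coeff p i) (coeff q i) (coeff r i) (coeff s i) ⟩
  (coeff p i ℤ.+ coeff r i) ℤ.+ (coeff q i ℤ.+ coeff s i)
    ≡⟨ trans (coeff-⊕ (p ⊕ r) _ i) (cong₂ ℤ._+_ (coeff-⊕ p r i) (coeff-⊕ q s i)) ⟨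
  coeff ((p ⊕ r) ⊕ (q ⊕ s)) i ∎
  where
  open ≡-Reasoning
  interchange : ∀ w x y z → (w ℤ.+ x) ℤ.+ (y ℤ.+ z) ≡ (w ℤ.+ y) ℤ.+ (x ℤ.+ z)
  interchange = ℤ-Solver.solve-∀

negate : Poly → Poly
negate []      = []
negate (a ∷ p) = ℤ.- a ∷ negate p

coeff-negate : ∀ p i → coeff (negate p) i ≡ ℤ.- coeff p i
coeff-negate []      i       = refl
coeff-negate (a ∷ p) zero    = refl
coeff-negate (a ∷ p) (suc i) = coeff-negate p i

negate-cong : ∀ {p q} → p ≋ q → negate p ≋ negate q
negate-cong {p} {q} e = coeffwise λ i →
  trans (coeff-negate p i) (trans (cong ℤ.-_ (coeff-≡ e i)) (sym (coeff-negate q i)))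

⊕-inverseʳ : ∀ p → p ⊕ negate p ≋ []
⊕-inverseʳ p = coeffwise λ i →
  trans (coeff-⊕ p (negate p) i) (trans (cong (ℤ._+_ (coeff p i)) (coeff-negate p i)) (ℤP.+-inverseʳ (coeff p i)))

scale-distribˡ : ∀ c p q → scale c (p ⊕ q) ≋ scale c p ⊕ scale c q
scale-distribˡ c p q = coeffwise λ i → begin
  coeff (scale c (p ⊕ q)) i                   ≡⟨ trans (coeff-scale c (p ⊕ q) i) (cong (c ℤ.*_) (coeff-⊕ p q i)) ⟩
  c ℤ.* (coeff p i ℤ.+ coeff q i)             ≡⟨ ℤP.*-distribˡ-+ c _ _ ⟩
  c ℤ.* coeff p i ℤ.+ c ℤ.* coeff q i         ≡⟨ trans (coeff-⊕ (scale c p) _ i)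
                                                        (cong₂ ℤ._+_ (coeff-scale c p i) (coeff-scale c q i)) ⟨
  coeff (scale c p ⊕ scale c q) i             ∎
  where open ≡-Reasoning

scale-distribʳ : ∀ c c′ p → scale (c ℤ.+ c′) p ≋ scale c p ⊕ scale c′ p
scale-distribʳ c c′ p = coeffwise λ i → begin
  coeff (scale (c ℤ.+ c′) p) i                ≡⟨ coeff-scale (c ℤ.+ c′) p i ⟩
  (c ℤ.+ c′) ℤ.* coeff p i                    ≡⟨ ℤP.*-distribʳ-+ (coeff p i) c c′ ⟩
  c ℤ.* coeff p i ℤ.+ c′ ℤ.* coeff p i        ≡⟨ trans (coeff-⊕ (scale c p) _ i)
                                                        (cong₂ ℤ._+_ (coeff-scale c p i) (coeff-scale c′ p i)) ⟨
  coeff (scale c p ⊕ scale c′ p) i            ∎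
  where open ≡-Reasoning

scale-assoc : ∀ c c′ p → scale (c ℤ.* c′) p ≋ scale c (scale c′ p)
scale-assoc c c′ p = coeffwise λ i → begin
  coeff (scale (c ℤ.* c′) p) i          ≡⟨ trans (coeff-scale (c ℤ.* c′) p i) (ℤP.*-assoc c c′ _) ⟩
  c ℤ.* (c′ ℤ.* coeff p i)              ≡⟨ trans (coeff-scale c (scale c′ p) i) (cong (c ℤ.*_) (coeff-scale c′ p i)) ⟨
  coeff (scale c (scale c′ p)) i        ∎
  where open ≡-Reasoning

scale-∷-0 : ∀ c p → 0ℤ ∷ scale c p ≋ scale c (0ℤ ∷ p)
scale-∷-0 c p = coeffwise λ { zero → sym (ℤP.*-zeroʳ c) ; (suc i) → refl }

∷-split : ∀ a p → a ∷ p ≋ const a ⊕ (0ℤ ∷ p)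
∷-split a p = coeffwise λ { zero → sym (ℤP.+-identityʳ a) ; (suc i) → refl }

0∷[]≋[] : 0ℤ ∷ [] ≋ []
0∷[]≋[] = coeffwise λ { zero → refl ; (suc i) → refl }

⊛-zeroˡ : ∀ p q → p ≋ [] → p ⊛ q ≋ []
⊛-zeroˡ []      q e = ≋-refl
⊛-zeroˡ (a ∷ p) q e = coeffwise λ i →
  trans (coeff-∷-⊛ a p q i) (cong₂ (λ a′ r → a′ ℤ.* coeff q i ℤ.+ r) (coeff-≡ e zero) (shifted-zero i))
  where
  shifted-zero : ∀ i → coeff (0ℤ ∷ p ⊛ q) i ≡ 0ℤ
  shifted-zero zero    = refl
  shifted-zero (suc i) = coeff-≡ (⊛-zeroˡ p q (coeffwise λ j → coeff-≡ e (suc j))) i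

⊛-zeroʳ : ∀ p → p ⊛ [] ≋ []
⊛-zeroʳ []      = ≋-refl
⊛-zeroʳ (a ∷ p) = ∷-cong 0ℤ (⊛-zeroʳ p) ⟫ 0∷[]≋[]

⊛-congʳ : ∀ p {q q′} → q ≋ q′ → p ⊛ q ≋ p ⊛ q′
⊛-congʳ []      e = ≋-refl
⊛-congʳ (a ∷ p) e = ⊕-cong (scale-cong a e) (∷-cong 0ℤ (⊛-congʳ p e))

⊛-congˡ : ∀ {p p′} q → p ≋ p′ → p ⊛ q ≋ p′ ⊛ q
⊛-congˡ {[]}    {p′}     q e = ≋-sym (⊛-zeroˡ p′ q (≋-sym e))
⊛-congˡ {a ∷ p} {[]}     q e = ⊛-zeroˡ (a ∷ p) q e
⊛-congˡ {a ∷ p} {b ∷ p′} q e rewrite coeff-≡ e zero =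
  ⊕-cong (≋-refl {scale b q}) (∷-cong 0ℤ (⊛-congˡ {p} {p′} q (coeffwise λ j → coeff-≡ e (suc j))))

⊛-cong : ∀ {p p′ q q′} → p ≋ p′ → q ≋ q′ → p ⊛ q ≋ p′ ⊛ q′
⊛-cong {p′ = p′} {q} e f = ⊛-congˡ q e ⟫ ⊛-congʳ p′ f

const-⊛ : ∀ a q → const a ⊛ q ≋ scale a q
const-⊛ a q = ⊕-cong (≋-refl {scale a q}) 0∷[]≋[] ⟫ ⊕-identityʳ (scale a q)

⊛-distribʳ : ∀ p p′ q → (p ⊕ p′) ⊛ q ≋ p ⊛ q ⊕ p′ ⊛ q
⊛-distribʳ []      p′       q = ≋-refl
⊛-distribʳ (a ∷ p) []       q = ≋-sym (⊕-identityʳ _)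
⊛-distribʳ (a ∷ p) (b ∷ p′) q =
  ⊕-cong (scale-distribʳ a b q) (∷-cong 0ℤ (⊛-distribʳ p p′ q))
  ⟫ ⊕-interchange (scale a q) (scale b q) (0ℤ ∷ p ⊛ q) (0ℤ ∷ p′ ⊛ q)

⊛-distribˡ : ∀ p q q′ → p ⊛ (q ⊕ q′) ≋ p ⊛ q ⊕ p ⊛ q′
⊛-distribˡ []      q q′ = ≋-refl
⊛-distribˡ (a ∷ p) q q′ =
  ⊕-cong (scale-distribˡ a q q′) (∷-cong 0ℤ (⊛-distribˡ p q q′))
  ⟫ ⊕-interchange (scale a q) (scale a q′) (0ℤ ∷ p ⊛ q) (0ℤ ∷ p ⊛ q′)

scale-⊛ : ∀ c p q → scale c p ⊛ q ≋ scale c (p ⊛ q)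
scale-⊛ c []      q = ≋-refl
scale-⊛ c (a ∷ p) q =
  ⊕-cong (scale-assoc c a q) (∷-cong 0ℤ (scale-⊛ c p q) ⟫ scale-∷-0 c (p ⊛ q))
  ⟫ ≋-sym (scale-distribˡ c (scale a q) (0ℤ ∷ p ⊛ q))

∷-0-⊛ : ∀ p q → (0ℤ ∷ p) ⊛ q ≋ 0ℤ ∷ p ⊛ q
∷-0-⊛ p q = coeffwise λ i →
  trans (coeff-∷-⊛ 0ℤ p q i) (trans (cong (ℤ._+ coeff (0ℤ ∷ p ⊛ q) i) (ℤP.*-zeroˡ (coeff q i))) (ℤP.+-identityˡ _))

⊛-∷-0 : ∀ p q → p ⊛ (0ℤ ∷ q) ≋ 0ℤ ∷ p ⊛ q
⊛-∷-0 []      q = coeffwise λ { zero → refl ; (suc i) → refl }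
⊛-∷-0 (a ∷ p) q = coeffwise λ
  { zero    → trans (coeff-∷-⊛ a p (0ℤ ∷ q) zero) (trans (ℤP.+-identityʳ _) (ℤP.*-zeroʳ a))
  ; (suc i) → trans (coeff-∷-⊛ a p (0ℤ ∷ q) (suc i))
                    (trans (cong (ℤ._+_ (a ℤ.* coeff q i)) (coeff-≡ (⊛-∷-0 p q) i)) (sym (coeff-∷-⊛ a p q i)))
  }

⊛-const : ∀ p b → p ⊛ const b ≋ scale b p
⊛-const []      b = ≋-refl
⊛-const (a ∷ p) b = ⊕-cong (≋-refl {scale a (const b)}) (∷-cong 0ℤ (⊛-const p b)) ⟫ coeffwise leading
  where
  leading : scale a (const b) ⊕ (0ℤ ∷ scale b p) ≈ scale b (a ∷ p)
  leading zero    = trans (ℤP.+-identityʳ _) (ℤP.*-comm a b)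
  leading (suc i) = refl

⊛-comm : ∀ p q → p ⊛ q ≋ q ⊛ p
⊛-comm []      q = ≋-sym (⊛-zeroʳ q)
⊛-comm (a ∷ p) q = ⊕-cong (≋-refl {scale a q}) (∷-cong 0ℤ (⊛-comm p q)) ⟫ ≋-sym
  (⊛-congʳ q (∷-split a p) ⟫ ⊛-distribˡ q (const a) (0ℤ ∷ p) ⟫ ⊕-cong (⊛-const q a) (⊛-∷-0 q p))

⊛-assoc : ∀ p q r → (p ⊛ q) ⊛ r ≋ p ⊛ (q ⊛ r)
⊛-assoc []      q r = ≋-refl
⊛-assoc (a ∷ p) q r = ⊛-distribʳ (scale a q) (0ℤ ∷ p ⊛ q) r
  ⟫ ⊕-cong (scale-⊛ a q r) (∷-0-⊛ (p ⊛ q) r ⟫ ∷-cong 0ℤ (⊛-assoc p q r))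

⊛-identityˡ : ∀ p → const 1ℤ ⊛ p ≋ p
⊛-identityˡ p = const-⊛ 1ℤ p ⟫ coeffwise λ i → trans (coeff-scale 1ℤ p i) (ℤP.*-identityˡ _)

⊛-identityʳ : ∀ p → p ⊛ const 1ℤ ≋ p
⊛-identityʳ p = ⊛-comm p _ ⟫ ⊛-identityˡ p

ℤ[x] : CommutativeRing _ _
ℤ[x] = record
  { Carrier = Poly ; _≈_ = _≋_ ; _+_ = _⊕_ ; _*_ = _⊛_ ; -_ = negate ; 0# = [] ; 1# = const 1ℤ
  ; isCommutativeRing = record
    { isRing = record
      { +-isAbelianGroup = record
        { isGroup = record
          { isMonoid = record
            { isSemigroup = record
              { isMagma = record
                { isEquivalence = record { refl = ≋-refl ; sym = ≋-sym ; trans = _⟫_ }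
                ; ∙-cong = ⊕-cong }
              ; assoc = ⊕-assoc }
            ; identity = (λ p → ≋-refl) , ⊕-identityʳ }
          ; inverse = (λ p → ⊕-comm (negate p) p ⟫ ⊕-inverseʳ p) , ⊕-inverseʳ
          ; ⁻¹-cong = negate-cong }
        ; comm = ⊕-comm }
      ; *-cong = ⊛-cong
      ; *-assoc = ⊛-assoc
      ; *-identity = ⊛-identityˡ , ⊛-identityʳ
      ; distrib = ⊛-distribˡ , λ p q r → ⊛-distribʳ q r p }
    ; *-comm = ⊛-comm } }

ℤ[x]-solver : AlmostCommutativeRing _ _
ℤ[x]-solver = fromCommutativeRing ℤ[x] ≋-zero?
  where
  ≋-zero? : ∀ p → Maybe ([] ≋ p)
  ≋-zero? []      = just ≋-refl
  ≋-zero? (a ∷ p) with a ℤ.≟ 0ℤ | ≋-zero? p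
  ... | yes a≡0 | just p≋0 = just (coeffwise λ { zero → sym a≡0 ; (suc i) → coeff-≡ p≋0 i })
  ... | _       | _        = nothing

-- Divisibility and degree

infix 4 _∣_
record _∣_ (x y : Poly) : Set where
  constructor divides
  field
    quotient : Poly
    quotient-≋ : x ⊛ quotient ≋ y
open _∣_ public

∣⇒∣ₚ : ∀ {x y} → x ∣ y → x ∣ₚ y
∣⇒∣ₚ (divides r e) = r , coeff-≡ e

∣ₚ⇒∣ : ∀ {x y} → x ∣ₚ y → x ∣ y
∣ₚ⇒∣ (r , e) = divides r (coeffwise e)

∣-refl : ∀ {x} → x ∣ x
∣-refl {x} = divides (const 1ℤ) (⊛-identityʳ x)

∣-trans : ∀ {x y z} → x ∣ y → y ∣ z → x ∣ z
∣-trans {x} (divides r e) (divides s f) = divides (r ⊛ s) (≋-sym (⊛-assoc x r s) ⟫ ⊛-congˡ s e ⟫ f)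

∣-respʳ : ∀ {x y y′} → y ≋ y′ → x ∣ y → x ∣ y′
∣-respʳ e (divides r f) = divides r (f ⟫ e)

∣-zero : ∀ {x} → x ∣ []
∣-zero {x} = divides [] (⊛-zeroʳ x)

∣-⊕ : ∀ {x y z} → x ∣ y → x ∣ z → x ∣ y ⊕ z
∣-⊕ {x} (divides r e) (divides s f) = divides (r ⊕ s) (⊛-distribˡ x r s ⟫ ⊕-cong e f)

∣-⊛ˡ : ∀ {x y} z → x ∣ y → x ∣ z ⊛ y
∣-⊛ˡ {x} z (divides r e) = divides (z ⊛ r) (swap x z r ⟫ ⊛-congʳ z e)
  where
  swap : ∀ x z r → x ⊛ (z ⊛ r) ≋ z ⊛ (x ⊛ r)
  swap = Solver.solve-∀ ℤ[x]-solver

∣-⊛ʳ : ∀ {x y} z → x ∣ y → x ∣ y ⊛ z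
∣-⊛ʳ {y = y} z x∣y = ∣-respʳ (⊛-comm z y) (∣-⊛ˡ z x∣y)

∣-⊕-cancelʳ : ∀ {x y z} → x ∣ y ⊕ z → x ∣ z → x ∣ y
∣-⊕-cancelʳ {y = y} {z} x∣y⊕z x∣z =
  ∣-respʳ (subtract y z) (∣-⊕ x∣y⊕z (∣-respʳ (negate-as-product z) (∣-⊛ˡ (negate (const 1ℤ)) x∣z)))
  where
  negate-as-product : ∀ z → negate (const 1ℤ) ⊛ z ≋ negate z
  negate-as-product = Solver.solve-∀ ℤ[x]-solver
  subtract : ∀ y z → y ⊕ z ⊕ negate z ≋ y
  subtract = Solver.solve-∀ ℤ[x]-solver

∣-⊕-cancelˡ : ∀ {x y z} → x ∣ y ⊕ z → x ∣ y → x ∣ z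
∣-⊕-cancelˡ {y = y} {z} x∣y⊕z = ∣-⊕-cancelʳ (∣-respʳ (⊕-comm y z) x∣y⊕z)

Coprime : Poly → Poly → Set
Coprime a b = ∀ {c} → c ∣ a → c ∣ b → c ∣ const 1ℤ

coprimeP⇒coprime : ∀ {a b} → CoprimeP a b → Coprime a b
coprimeP⇒coprime (_ , _ , gcd-greatest) {c} c∣a c∣b = ∣ₚ⇒∣ (gcd-greatest c (∣⇒∣ₚ c∣a) (∣⇒∣ₚ c∣b))

coprime-∣ˡ : ∀ {a a′ b} → a′ ∣ a → Coprime a b → Coprime a′ b
coprime-∣ˡ a′∣a cop c∣a′ = cop (∣-trans c∣a′ a′∣a)

*-≢0 : ∀ {a b} → a ≢ 0ℤ → b ≢ 0ℤ → a ℤ.* b ≢ 0ℤ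
*-≢0 {a} a≢0 b≢0 ab≡0 with ℤP.i*j≡0⇒i≡0∨j≡0 a ab≡0
... | inj₁ a≡0 = a≢0 a≡0
... | inj₂ b≡0 = b≢0 b≡0

*-cancelˡ : ∀ c {a b} → c ≢ 0ℤ → c ℤ.* a ≡ c ℤ.* b → a ≡ b
*-cancelˡ c {a} {b} c≢0 = ℤP.*-cancelˡ-≡ c a b {{ℤ.≢-nonZero c≢0}}

const-⊛-coeff : ∀ c t i → coeff (const c ⊛ t) i ≡ c ℤ.* coeff t i
const-⊛-coeff c t i = trans (coeff-≡ (const-⊛ c t) i) (coeff-scale c t i)

const-⊛-const : ∀ a b → const a ⊛ const b ≋ const (a ℤ.* b)
const-⊛-const a b = coeffwise λ { zero → ℤP.+-identityʳ _ ; (suc i) → refl }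

const-⊛-cancelˡ : ∀ c {x y} → c ≢ 0ℤ → const c ⊛ x ≋ const c ⊛ y → x ≋ y
const-⊛-cancelˡ c {x} {y} c≢0 e = coeffwise λ i →
  *-cancelˡ c c≢0 (trans (sym (const-⊛-coeff c x i)) (trans (coeff-≡ e i) (const-⊛-coeff c y i)))

DegreeBelow : Poly → ℕ → Set
DegreeBelow p n = ∀ i → n ≤ i → coeff p i ≡ 0ℤ

HasDegree : Poly → ℕ → Set
HasDegree p m = DegreeBelow p (suc m) × coeff p m ≢ 0ℤ

DegreeBelow-mono : ∀ {p m n} → m ≤ n → DegreeBelow p m → DegreeBelow p n
DegreeBelow-mono m≤n below i n≤i = below i (ℕP.≤-trans m≤n n≤i)

DegreeBelow-∷ : ∀ {a p n} → DegreeBelow p n → DegreeBelow (a ∷ p) (suc n)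
DegreeBelow-∷ below (suc i) (s≤s n≤i) = below i n≤i

DegreeBelow-length : ∀ p → DegreeBelow p (length p)
DegreeBelow-length []      i _ = refl
DegreeBelow-length (a ∷ p) = DegreeBelow-∷ {a} (DegreeBelow-length p)

constant-form : ∀ {p} → DegreeBelow p 1 → p ≋ const (coeff p 0)
constant-form below = coeffwise λ { zero → refl ; (suc i) → below (suc i) (s≤s z≤n) }

zero-or-degree : ∀ p → (p ≋ []) ⊎ (∃ λ m → HasDegree p m)
zero-or-degree []      = inj₁ ≋-refl
zero-or-degree (a ∷ p) with zero-or-degree p
... | inj₂ (m , below , lead≢0) = inj₂ (suc m , DegreeBelow-∷ {a} below , lead≢0)
... | inj₁ p≋0 with a ℤ.≟ 0ℤ
...   | yes a≡0 = inj₁ (coeffwise λ { zero → a≡0 ; (suc i) → coeff-≡ p≋0 i })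
...   | no  a≢0 = inj₂ (0 , (λ { (suc i) _ → coeff-≡ p≋0 i }) , a≢0)

leading-⊛ : ∀ p q m n → DegreeBelow p (suc m) → DegreeBelow q (suc n) →
  DegreeBelow (p ⊛ q) (suc (m ℕ.+ n)) × (coeff (p ⊛ q) (m ℕ.+ n) ≡ coeff p m ℤ.* coeff q n)
leading-⊛ []      q m       n bp bq = (λ _ _ → refl) , sym (ℤP.*-zeroˡ (coeff q n))
leading-⊛ (a ∷ p) q zero    n bp bq =
  (λ i n<i → trans (scaled i) (trans (cong (a ℤ.*_) (bq i n<i)) (ℤP.*-zeroʳ a))) , scaled n
  where
  scaled : ∀ i → coeff ((a ∷ p) ⊛ q) i ≡ a ℤ.* coeff q i
  scaled i = trans (coeff-∷-⊛ a p q i) (trans (cong (ℤ._+_ (a ℤ.* coeff q i)) (shifted i)) (ℤP.+-identityʳ _))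
    where
    shifted : ∀ i → coeff (0ℤ ∷ p ⊛ q) i ≡ 0ℤ
    shifted zero    = refl
    shifted (suc i) = coeff-≡ (⊛-zeroˡ p q (coeffwise λ j → bp (suc j) (s≤s z≤n))) i
leading-⊛ (a ∷ p) q (suc m) n bp bq = below , leading
  where
  IH : DegreeBelow (p ⊛ q) (suc (m ℕ.+ n)) × (coeff (p ⊛ q) (m ℕ.+ n) ≡ coeff p m ℤ.* coeff q n)
  IH = leading-⊛ p q m n (λ i m<i → bp (suc i) (s≤s m<i)) bq
  below : DegreeBelow ((a ∷ p) ⊛ q) (suc (suc m ℕ.+ n))
  below (suc i) (s≤s m+n<i) = trans (coeff-∷-⊛ a p q (suc i))
    (trans (cong₂ (λ x y → a ℤ.* x ℤ.+ y) (bq (suc i) (s≤s (ℕP.≤-trans (ℕP.m≤n+m n m) (ℕP.<⇒≤ m+n<i)))) (proj₁ IH i m+n<i))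
           (cong (ℤ._+ 0ℤ) (ℤP.*-zeroʳ a)))
  leading : coeff ((a ∷ p) ⊛ q) (suc (m ℕ.+ n)) ≡ coeff p m ℤ.* coeff q n
  leading = trans (coeff-∷-⊛ a p q (suc (m ℕ.+ n)))
    (trans (cong₂ (λ x y → a ℤ.* x ℤ.+ y) (bq (suc (m ℕ.+ n)) (s≤s (ℕP.m≤n+m n m))) (proj₂ IH))
           (trans (cong (ℤ._+ (coeff p m ℤ.* coeff q n)) (ℤP.*-zeroʳ a)) (ℤP.+-identityˡ _)))

HasDegree-⊛ : ∀ {p q m n} → HasDegree p m → HasDegree q n → HasDegree (p ⊛ q) (m ℕ.+ n)
HasDegree-⊛ {p} {q} {m} {n} (bp , p≢0) (bq , q≢0) with leading-⊛ p q m n bp bq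
... | below , leading = below , λ lead≡0 → *-≢0 p≢0 q≢0 (trans (sym leading) lead≡0)

∣-const⇒constant : ∀ {x k} → x ∣ const k → k ≢ 0ℤ → DegreeBelow x 1
∣-const⇒constant {x} (divides r e) k≢0 with zero-or-degree x | zero-or-degree r
... | inj₁ x≋0 | _ = ⊥-elim (k≢0 (trans (sym (coeff-≡ e 0)) (coeff-≡ (⊛-zeroˡ x r x≋0) 0)))
... | inj₂ _ | inj₁ r≋0 = ⊥-elim (k≢0 (trans (sym (coeff-≡ e 0)) (coeff-≡ (⊛-congʳ x r≋0 ⟫ ⊛-zeroʳ x) 0)))
... | inj₂ (zero , deg-x)  | inj₂ _           = proj₁ deg-x
... | inj₂ (suc m , deg-x) | inj₂ (n , deg-r) =
  ⊥-elim (proj₂ (HasDegree-⊛ {x} {r} deg-x deg-r) (coeff-≡ e (suc m ℕ.+ n)))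

-- Pseudo-division

monomial : ℕ → Poly
monomial zero    = const 1ℤ
monomial (suc k) = 0ℤ ∷ monomial k

coeff-monomial-⊛ : ∀ k b j → coeff (monomial k ⊛ b) (k ℕ.+ j) ≡ coeff b j
coeff-monomial-⊛ zero    b j = coeff-≡ (⊛-identityˡ b) j
coeff-monomial-⊛ (suc k) b j = trans (coeff-≡ (∷-0-⊛ (monomial k) b) (suc (k ℕ.+ j))) (coeff-monomial-⊛ k b j)

cancel-leading : ∀ {a b n N} → HasDegree b n → n ≤ N → DegreeBelow a (suc N) →
  DegreeBelow (const (coeff b n) ⊛ a ⊕ negate (const (coeff a N) ⊛ (monomial (N ∸ n) ⊛ b))) N
cancel-leading {a} {b} {n} {N} (b-below , _) n≤N a-below i N≤i =
  trans (coeff-difference i) (subst (λ i → lb ℤ.* coeff a i ℤ.- la ℤ.* coeff (monomial k ⊛ b) i ≡ 0ℤ) k+j≡i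
         (vanishes-at (i ∸ k) (ℕP.+-cancelˡ-≤ k n (i ∸ k) (subst₂ _≤_ (sym k+n≡N) (sym k+j≡i) N≤i))))
  where
  lb la : ℤ
  lb = coeff b n
  la = coeff a N
  k : ℕ
  k  = N ∸ n
  k+n≡N : k ℕ.+ n ≡ N
  k+n≡N = ℕP.m∸n+n≡m n≤N
  k+j≡i : k ℕ.+ (i ∸ k) ≡ i
  k+j≡i = ℕP.m+[n∸m]≡n (ℕP.≤-trans (ℕP.m≤m+n k n) (subst (_≤ i) (sym k+n≡N) N≤i))
  coeff-difference : ∀ i → coeff (const lb ⊛ a ⊕ negate (const la ⊛ (monomial k ⊛ b))) i
                         ≡ lb ℤ.* coeff a i ℤ.- la ℤ.* coeff (monomial k ⊛ b) i
  coeff-difference i = trans (coeff-⊕ (const lb ⊛ a) _ i)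
    (cong₂ ℤ._+_ (const-⊛-coeff lb a i)
                 (trans (coeff-negate (const la ⊛ (monomial k ⊛ b)) i) (cong ℤ.-_ (const-⊛-coeff la (monomial k ⊛ b) i))))
  vanishes-at : ∀ j → n ≤ j → lb ℤ.* coeff a (k ℕ.+ j) ℤ.- la ℤ.* coeff (monomial k ⊛ b) (k ℕ.+ j) ≡ 0ℤ
  vanishes-at j n≤j rewrite coeff-monomial-⊛ k b j with ℕP.m≤n⇒m<n∨m≡n n≤j
  ... | inj₂ refl rewrite k+n≡N = cancel lb la
    where
    cancel : ∀ x y → x ℤ.* y ℤ.- y ℤ.* x ≡ 0ℤ
    cancel = ℤ-Solver.solve-∀
  ... | inj₁ n<j rewrite a-below (k ℕ.+ j) (subst (_< k ℕ.+ j) k+n≡N (ℕP.+-monoʳ-< k n<j))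
                       | b-below j n<j = cancel lb la
    where
    cancel : ∀ x y → x ℤ.* 0ℤ ℤ.- y ℤ.* 0ℤ ≡ 0ℤ
    cancel = ℤ-Solver.solve-∀

record PseudoDivision (a b : Poly) (n : ℕ) : Set where
  field
    factor     : ℤ
    factor≢0   : factor ≢ 0ℤ
    quot rem   : Poly
    equation   : const factor ⊛ a ≋ quot ⊛ b ⊕ rem
    rem-degree : DegreeBelow rem n

no-division : ∀ {a b n} → DegreeBelow a n → PseudoDivision a b n
no-division {a} a-below = record { factor = 1ℤ ; factor≢0 = λ () ; quot = [] ; rem = a
                                 ; equation = ⊛-identityˡ a ; rem-degree = a-below }

pseudo-divide-below : ∀ {b n} → HasDegree b n → ∀ N a → DegreeBelow a N → PseudoDivision a b n
pseudo-divide-below deg-b zero    a a-below = no-division (DegreeBelow-mono {a} z≤n a-below)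
pseudo-divide-below {b} {n} deg-b (suc N) a a-below with suc N ℕ.≤? n
... | yes N<n = no-division (DegreeBelow-mono {a} N<n a-below)
... | no  N≮n = record
  { factor     = K ℤ.* lb
  ; factor≢0   = *-≢0 factor≢0 (proj₂ deg-b)
  ; quot       = quot ⊕ const K ⊛ (const la ⊛ xᵏ)
  ; rem        = rem
  ; equation   = ⊛-congˡ a (≋-sym (const-⊛-const K lb)) ⟫ ⊛-assoc (const K) (const lb) a
                 ⟫ split-off (const K) (const lb) a (const la) xᵏ b
                 ⟫ ⊕-cong equation (≋-refl {const K ⊛ (const la ⊛ xᵏ) ⊛ b})
                 ⟫ regroup quot b rem (const K ⊛ (const la ⊛ xᵏ))
  ; rem-degree = rem-degree
  }
  where
  n≤N : n ≤ N
  n≤N = ℕP.≤-pred (ℕP.≰⇒> N≮n)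
  lb la : ℤ
  lb = coeff b n
  la = coeff a N
  xᵏ : Poly
  xᵏ = monomial (N ∸ n)
  open PseudoDivision (pseudo-divide-below {b} deg-b N (const lb ⊛ a ⊕ negate (const la ⊛ (xᵏ ⊛ b)))
                                          (cancel-leading {a} {b} deg-b n≤N a-below)) renaming (factor to K)
  split-off : ∀ k l a m x b → k ⊛ (l ⊛ a) ≋ k ⊛ (l ⊛ a ⊕ negate (m ⊛ (x ⊛ b))) ⊕ k ⊛ (m ⊛ x) ⊛ b
  split-off = Solver.solve-∀ ℤ[x]-solver
  regroup : ∀ q b r t → (q ⊛ b ⊕ r) ⊕ t ⊛ b ≋ (q ⊕ t) ⊛ b ⊕ r
  regroup = Solver.solve-∀ ℤ[x]-solver

pseudo-divide : ∀ a {b n} → HasDegree b n → PseudoDivision a b n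
pseudo-divide a deg-b = pseudo-divide-below deg-b (length a) a (DegreeBelow-length a)

-- Gauss's lemma

DividesAllCoeffs : ℕ → Poly → Set
DividesAllCoeffs p f = ∀ i → + p SD.∣ coeff f i

DividesAllCoeffs-resp : ∀ {p f g} → f ≋ g → DividesAllCoeffs p f → DividesAllCoeffs p g
DividesAllCoeffs-resp e p∣f i = subst (_ SD.∣_) (coeff-≡ e i) (p∣f i)

dividesAllCoeffs? : ∀ p f → Dec (DividesAllCoeffs p f)
dividesAllCoeffs? p []      = yes λ i → SD.divides 0ℤ (sym (ℤP.*-zeroˡ (+ p)))
dividesAllCoeffs? p (a ∷ f) with + p SD.∣? a | dividesAllCoeffs? p f
... | yes p∣a | yes p∣f = yes λ { zero → p∣a ; (suc i) → p∣f i }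
... | no  p∤a | _       = no λ p∣af → p∤a (p∣af zero)
... | yes _   | no  p∤f = no λ p∣af → p∤f (λ i → p∣af (suc i))

DividesAllCoeffs-const-⊛ : ∀ p t → DividesAllCoeffs p (const (+ p) ⊛ t)
DividesAllCoeffs-const-⊛ p t i = subst (+ p SD.∣_) (sym (const-⊛-coeff (+ p) t i)) (SD.∣m⇒∣m*n (coeff t i) SD.∣-refl)

DividesAllCoeffs⇒factor : ∀ {p} f → DividesAllCoeffs p f → ∃ λ t → f ≋ const (+ p) ⊛ t
DividesAllCoeffs⇒factor {p} []      p∣f = [] , ≋-sym (⊛-zeroʳ (const (+ p)))
DividesAllCoeffs⇒factor {p} (a ∷ f) p∣f with p∣f zero | DividesAllCoeffs⇒factor f (λ i → p∣f (suc i))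
... | SD.divides q a≡qp | t , f≋pt = (q ∷ t) , coeffwise λ
  { zero    → trans a≡qp (trans (ℤP.*-comm q (+ p)) (sym (const-⊛-coeff (+ p) (q ∷ t) zero)))
  ; (suc i) → trans (coeff-≡ f≋pt i) (trans (const-⊛-coeff (+ p) t i) (sym (const-⊛-coeff (+ p) (q ∷ t) (suc i))))
  }

DividesAllCoeffs⇒∣ : ∀ {p} f → DividesAllCoeffs p f → const (+ p) ∣ f
DividesAllCoeffs⇒∣ f p∣f = divides (proj₁ (DividesAllCoeffs⇒factor f p∣f)) (≋-sym (proj₂ (DividesAllCoeffs⇒factor f p∣f)))

DividesAllCoeffs-⊕-cancelʳ : ∀ {p f g} → DividesAllCoeffs p (f ⊕ g) → DividesAllCoeffs p g → DividesAllCoeffs p f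
DividesAllCoeffs-⊕-cancelʳ {f = f} {g} p∣f+g p∣g i =
  SD.∣m+n∣n⇒∣m (subst (_ SD.∣_) (coeff-⊕ f g i) (p∣f+g i)) (p∣g i)

ReducedMod : ℕ → Poly → Set
ReducedMod p f = ∀ i → coeff f i ≢ 0ℤ → ¬ (+ p SD.∣ coeff f i)

coeff-⊕-const-⊛ : ∀ f c t i → coeff (f ⊕ const c ⊛ t) i ≡ coeff f i ℤ.+ c ℤ.* coeff t i
coeff-⊕-const-⊛ f c t i = trans (coeff-⊕ f (const c ⊛ t) i) (cong (ℤ._+_ (coeff f i)) (const-⊛-coeff c t i))

reduce-mod : ∀ p f → ∃₂ λ f̄ t → (f ≋ f̄ ⊕ const (+ p) ⊛ t) × ReducedMod p f̄
reduce-mod p []      = [] , [] , ≋-sym (⊛-zeroʳ (const (+ p))) , λ i a≢0 _ → a≢0 refl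
reduce-mod p (a ∷ f) with reduce-mod p f | + p SD.∣? a
... | f̄ , t , f≋ , reduced | yes (SD.divides q a≡qp) = (0ℤ ∷ f̄) , (q ∷ t) , coeffwise split , reduced′
  where
  reduced′ : ReducedMod p (0ℤ ∷ f̄)
  reduced′ zero    0≢0 = ⊥-elim (0≢0 refl)
  reduced′ (suc i)     = reduced i
  split : (a ∷ f) ≈ (0ℤ ∷ f̄) ⊕ const (+ p) ⊛ (q ∷ t)
  split zero    = trans a≡qp (trans (ℤP.*-comm q (+ p))
                    (sym (trans (coeff-⊕-const-⊛ (0ℤ ∷ f̄) (+ p) (q ∷ t) 0) (ℤP.+-identityˡ _))))
  split (suc i) = trans (coeff-≡ f≋ i)
                    (trans (coeff-⊕-const-⊛ f̄ (+ p) t i) (sym (coeff-⊕-const-⊛ (0ℤ ∷ f̄) (+ p) (q ∷ t) (suc i))))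
... | f̄ , t , f≋ , reduced | no p∤a = (a ∷ f̄) , (0ℤ ∷ t) , coeffwise split , reduced′
  where
  reduced′ : ReducedMod p (a ∷ f̄)
  reduced′ zero    _ = p∤a
  reduced′ (suc i)   = reduced i
  split : (a ∷ f) ≈ (a ∷ f̄) ⊕ const (+ p) ⊛ (0ℤ ∷ t)
  split zero    = sym (trans (coeff-⊕-const-⊛ (a ∷ f̄) (+ p) (0ℤ ∷ t) 0)
                    (trans (cong (ℤ._+_ a) (ℤP.*-zeroʳ (+ p))) (ℤP.+-identityʳ a)))
  split (suc i) = trans (coeff-≡ f≋ i)
                    (trans (coeff-⊕-const-⊛ f̄ (+ p) t i) (sym (coeff-⊕-const-⊛ (a ∷ f̄) (+ p) (0ℤ ∷ t) (suc i))))

prime-∣-* : ∀ {p} → Prime p → ∀ a b → + p SD.∣ a ℤ.* b → + p SD.∣ a ⊎ + p SD.∣ b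
prime-∣-* {p} p-prime a b p∣ab
  with euclidsLemma ℤ.∣ a ∣ ℤ.∣ b ∣ p-prime (subst (p ℕD.∣_) (ℤP.abs-* a b) (SD.∣⇒∣ᵤ p∣ab))
... | inj₁ p∣a = inj₁ (SD.∣ᵤ⇒∣ p∣a)
... | inj₂ p∣b = inj₂ (SD.∣ᵤ⇒∣ p∣b)

-- p would divide the leading coefficient of ē·q̄, a product of leading coefficients of ē and q̄.
reduced-product : ∀ {p} → Prime p → ∀ ē q̄ → ReducedMod p ē → ReducedMod p q̄ →
  DividesAllCoeffs p (ē ⊛ q̄) → (ē ≋ []) ⊎ (q̄ ≋ [])
reduced-product {p} p-prime ē q̄ ē-reduced q̄-reduced p∣ēq̄ with zero-or-degree ē | zero-or-degree q̄
... | inj₁ ē≋0 | _ = inj₁ ē≋0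
... | inj₂ _ | inj₁ q̄≋0 = inj₂ q̄≋0
... | inj₂ (m , ē-below , ē≢0) | inj₂ (n , q̄-below , q̄≢0)
  with prime-∣-* p-prime (coeff ē m) (coeff q̄ n)
         (subst (_ SD.∣_) (proj₂ (leading-⊛ ē q̄ m n ē-below q̄-below)) (p∣ēq̄ (m ℕ.+ n)))
... | inj₁ p∣lead-ē = ⊥-elim (ē-reduced m ē≢0 p∣lead-ē)
... | inj₂ p∣lead-q̄ = ⊥-elim (q̄-reduced n q̄≢0 p∣lead-q̄)

expand-mod : ∀ ē t q̄ u P → (ē ⊕ P ⊛ t) ⊛ (q̄ ⊕ P ⊛ u) ≋ ē ⊛ q̄ ⊕ P ⊛ (t ⊛ q̄ ⊕ ē ⊛ u ⊕ P ⊛ t ⊛ u)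
expand-mod = Solver.solve-∀ ℤ[x]-solver

gauss : ∀ {p} → Prime p → ∀ e q → DividesAllCoeffs p (e ⊛ q) → DividesAllCoeffs p e ⊎ DividesAllCoeffs p q
gauss {p} p-prime e q p∣eq with reduce-mod p e | reduce-mod p q
... | ē , t , e≋ , ē-reduced | q̄ , u , q≋ , q̄-reduced =
  from-reduced (reduced-product p-prime ē q̄ ē-reduced q̄-reduced p∣ēq̄)
  where
  P : Poly
  P = const (+ p)
  p∣ēq̄ : DividesAllCoeffs p (ē ⊛ q̄)
  p∣ēq̄ = DividesAllCoeffs-⊕-cancelʳ {f = ē ⊛ q̄} (DividesAllCoeffs-resp (⊛-cong e≋ q≋ ⟫ expand-mod ē t q̄ u P) p∣eq)
                                                 (DividesAllCoeffs-const-⊛ p (t ⊛ q̄ ⊕ ē ⊛ u ⊕ P ⊛ t ⊛ u))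
  from-reduced : (ē ≋ []) ⊎ (q̄ ≋ []) → DividesAllCoeffs p e ⊎ DividesAllCoeffs p q
  from-reduced (inj₁ ē≋0) = inj₁ (DividesAllCoeffs-resp (≋-sym (e≋ ⟫ ⊕-cong ē≋0 ≋-refl)) (DividesAllCoeffs-const-⊛ p t))
  from-reduced (inj₂ q̄≋0) = inj₂ (DividesAllCoeffs-resp (≋-sym (q≋ ⟫ ⊕-cong q̄≋0 ≋-refl)) (DividesAllCoeffs-const-⊛ p u))

-- Euclid's lemma

prime>1 : ∀ {p} → Prime p → 1 < p
prime>1 {p} p-prime = ℕ.nonTrivial⇒n>1 p {{prime⇒nonTrivial p-prime}}

prime≢0 : ∀ {p} → Prime p → + p ≢ 0ℤ
prime≢0 p-prime refl with prime>1 p-prime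
... | ()

abs≡1⇒square≡1 : ∀ K → ℤ.∣ K ∣ ≡ 1 → K ℤ.* K ≡ 1ℤ
abs≡1⇒square≡1 (+ 1)       _ = refl
abs≡1⇒square≡1 ℤ.-[1+ 0 ] _ = refl

record PrimeSplit (K : ℤ) : Set where
  field
    p       : ℕ
    p-prime : Prime p
    K′      : ℤ
    K≡pK′   : K ≡ + p ℤ.* K′
    K′≢0    : K′ ≢ 0ℤ
    ∣K′∣<∣K∣ : ℤ.∣ K′ ∣ < ℤ.∣ K ∣

prime-split : ∀ K → K ≢ 0ℤ → ℤ.∣ K ∣ ≢ 1 → PrimeSplit K
prime-split K K≢0 ∣K∣≢1 = from-factorisation (factorise ℤ.∣ K ∣ {{ℤ.≢-nonZero K≢0}})
  where
  from-factorisation : PrimeFactorisation ℤ.∣ K ∣ → PrimeSplit K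
  from-factorisation record { factors = [] ; isFactorisation = ∣K∣≡1 } = ⊥-elim (∣K∣≢1 ∣K∣≡1)
  from-factorisation record { factors = p ∷ ps ; isFactorisation = ∣K∣≡p*ps ; factorsPrime = p-prime ∷ _ }
    with SD.∣ᵤ⇒∣ {+ p} {K} (ℕD.divides (product ps) (trans ∣K∣≡p*ps (ℕP.*-comm p (product ps))))
  ... | SD.divides K′ K≡K′p = record
    { p = p ; p-prime = p-prime ; K′ = K′ ; K≡pK′ = trans K≡K′p (ℤP.*-comm K′ (+ p)) ; K′≢0 = K′≢0
    ; ∣K′∣<∣K∣ = subst (ℤ.∣ K′ ∣ <_) (sym (trans (cong ℤ.∣_∣ K≡K′p) (ℤP.abs-* K′ (+ p))))
                       (ℕP.m<m*n ℤ.∣ K′ ∣ p {{ℤ.≢-nonZero K′≢0}} (prime>1 p-prime)) }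
    where
    K′≢0 : K′ ≢ 0ℤ
    K′≢0 K′≡0 = K≢0 (trans K≡K′p (cong (ℤ._* + p) K′≡0))

const-⊛-split : ∀ {K p K′} → K ≡ + p ℤ.* K′ → ∀ x → const K ⊛ x ≋ const (+ p) ⊛ (const K′ ⊛ x)
const-⊛-split {p = p} {K′} refl x = ⊛-congˡ x (≋-sym (const-⊛-const (+ p) K′)) ⟫ ⊛-assoc (const (+ p)) (const K′) x

∣-respˡ : ∀ {x x′ y} → x ≋ x′ → x ∣ y → x′ ∣ y
∣-respˡ {y = y} e (divides r f) = divides r (⊛-congˡ r (≋-sym e) ⟫ f)

unit⇒constant : ∀ {e} → e ∣ const 1ℤ → DegreeBelow e 1
unit⇒constant e∣1 = ∣-const⇒constant e∣1 λ ()

∣-cancel-const : ∀ c {e x} → c ≢ 0ℤ → const c ⊛ e ∣ const c ⊛ x → e ∣ x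
∣-cancel-const c {e} c≢0 (divides r ce*r≋cx) =
  divides r (const-⊛-cancelˡ c c≢0 (≋-sym (⊛-assoc (const c) e r) ⟫ ce*r≋cx))

∣-cancel-unit : ∀ K {e x} → ℤ.∣ K ∣ ≡ 1 → e ∣ const K ⊛ x → e ∣ x
∣-cancel-unit K {e} {x} ∣K∣≡1 e∣Kx = ∣-respʳ K*Kx≋x (∣-⊛ˡ (const K) e∣Kx)
  where
  K*Kx≋x : const K ⊛ (const K ⊛ x) ≋ x
  K*Kx≋x = ≋-sym (⊛-assoc (const K) (const K) x) ⟫ ⊛-congˡ x (const-⊛-const K K ⟫ const-≋ (abs≡1⇒square≡1 K ∣K∣≡1))
           ⟫ ⊛-identityˡ x

⊛-const-⊛-comm : ∀ x c y → x ⊛ (const c ⊛ y) ≋ const c ⊛ (x ⊛ y)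
⊛-const-⊛-comm x c y = swap x (const c) y
  where
  swap : ∀ x P y → x ⊛ (P ⊛ y) ≋ P ⊛ (x ⊛ y)
  swap = Solver.solve-∀ ℤ[x]-solver

-- By Gauss's lemma, p divides the content of the cofactor.
∣-cancel-prime : ∀ {p e x} → Prime p → ¬ DividesAllCoeffs p e → e ∣ const (+ p) ⊛ x → e ∣ x
∣-cancel-prime {p} {e} {x} p-prime p∤e (divides r er≋px) =
  [ (λ p∣e → ⊥-elim (p∤e p∣e)) , cancel ]′ (gauss p-prime e r p∣er)
  where
  p∣er : DividesAllCoeffs p (e ⊛ r)
  p∣er = DividesAllCoeffs-resp (≋-sym er≋px) (DividesAllCoeffs-const-⊛ p x)
  cancel : DividesAllCoeffs p r → e ∣ x
  cancel p∣r with DividesAllCoeffs⇒factor r p∣r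
  ... | r′ , r≋pr′ = divides r′ (const-⊛-cancelˡ (+ p) (prime≢0 p-prime)
                                  (≋-sym (⊛-const-⊛-comm e (+ p) r′) ⟫ ⊛-congʳ e (≋-sym r≋pr′) ⟫ er≋px))

DegreeBelow-const-⊛ : ∀ c {e n} → DegreeBelow e n → DegreeBelow (const c ⊛ e) n
DegreeBelow-const-⊛ c {e} e-below i n≤i = trans (const-⊛-coeff c e i) (trans (cong (c ℤ.*_) (e-below i n≤i)) (ℤP.*-zeroʳ c))

-- Coprimality in ℚ[x], phrased without fractions.
StronglyCoprime : Poly → Poly → Set
StronglyCoprime a b = ∀ {e} K₁ K₂ → K₁ ≢ 0ℤ → K₂ ≢ 0ℤ → e ∣ const K₁ ⊛ a → e ∣ const K₂ ⊛ b → DegreeBelow e 1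

-- Induction on a bound n for |K|: each step removes one prime factor of K, from e or from the dividends.
common-divisor-constant : ∀ {a b} → Coprime a b → ∀ n {K e} → ℤ.∣ K ∣ ≤ n → K ≢ 0ℤ →
  e ∣ const K ⊛ a → e ∣ const K ⊛ b → DegreeBelow e 1
common-divisor-constant cop n {K} K≤n K≢0 e∣Ka e∣Kb with ℤ.∣ K ∣ ℕ.≟ 1
... | yes ∣K∣≡1 = unit⇒constant (cop (∣-cancel-unit K ∣K∣≡1 e∣Ka) (∣-cancel-unit K ∣K∣≡1 e∣Kb))
common-divisor-constant cop zero    K≤0 K≢0 _ _ | no _ = ⊥-elim (K≢0 (ℤP.∣i∣≡0⇒i≡0 (ℕP.n≤0⇒n≡0 K≤0)))
common-divisor-constant {a} {b} cop (suc n) {K} {e} K≤n K≢0 e∣Ka e∣Kb | no ∣K∣≢1 =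
  by-content (dividesAllCoeffs? p e)
  where
  open PrimeSplit (prime-split K K≢0 ∣K∣≢1)
  K′≤n : ℤ.∣ K′ ∣ ≤ n
  K′≤n = ℕP.≤-pred (ℕP.<-≤-trans ∣K′∣<∣K∣ K≤n)
  by-content : Dec (DividesAllCoeffs p e) → DegreeBelow e 1
  by-content (yes p∣e) = remove-from-e (DividesAllCoeffs⇒factor e p∣e)
    where
    remove-from-e : ∃ (λ e′ → e ≋ const (+ p) ⊛ e′) → DegreeBelow e 1
    remove-from-e (e′ , e≋pe′) i 1≤i = trans (coeff-≡ e≋pe′ i)
      (DegreeBelow-const-⊛ (+ p) {e′} (common-divisor-constant cop n K′≤n K′≢0 (cancel a e∣Ka) (cancel b e∣Kb)) i 1≤i)
      where
      cancel : ∀ x → e ∣ const K ⊛ x → e′ ∣ const K′ ⊛ x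
      cancel x e∣Kx = ∣-cancel-const (+ p) (prime≢0 p-prime) (∣-respˡ e≋pe′ (∣-respʳ (const-⊛-split {p = p} K≡pK′ x) e∣Kx))
  by-content (no p∤e) = common-divisor-constant cop n K′≤n K′≢0 (cancel a e∣Ka) (cancel b e∣Kb)
    where
    cancel : ∀ x → e ∣ const K ⊛ x → e ∣ const K′ ⊛ x
    cancel x e∣Kx = ∣-cancel-prime p-prime p∤e (∣-respʳ (const-⊛-split {p = p} K≡pK′ x) e∣Kx)

const-⊛-const-⊛ : ∀ K L x → const K ⊛ (const L ⊛ x) ≋ const (K ℤ.* L) ⊛ x
const-⊛-const-⊛ K L x = ≋-sym (⊛-assoc (const K) (const L) x) ⟫ ⊛-congˡ x (const-⊛-const K L)

coprime⇒stronglyCoprime : ∀ {a b} → Coprime a b → StronglyCoprime a b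
coprime⇒stronglyCoprime {a} {b} cop K₁ K₂ K₁≢0 K₂≢0 e∣K₁a e∣K₂b =
  common-divisor-constant cop _ ℕP.≤-refl (*-≢0 K₁≢0 K₂≢0)
    (∣-respʳ (const-⊛-const-⊛ K₂ K₁ a ⟫ ⊛-congˡ a (const-≋ (ℤP.*-comm K₂ K₁))) (∣-⊛ˡ (const K₂) e∣K₁a))
    (∣-respʳ (const-⊛-const-⊛ K₁ K₂ b) (∣-⊛ˡ (const K₁) e∣K₂b))

record ConstantBezout (a b : Poly) : Set where
  field
    u v    : Poly
    K      : ℤ
    K≢0    : K ≢ 0ℤ
    bezout : u ⊛ a ⊕ v ⊛ b ≋ const K

∣-const-⊛-zero : ∀ {x y} c → y ≋ [] → x ∣ const c ⊛ y
∣-const-⊛-zero {y = y} c y≋0 = ∣-respʳ (≋-sym (⊛-congʳ (const c) y≋0 ⟫ ⊛-zeroʳ (const c))) ∣-zero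

stronglyCoprime-zero⇒constant : ∀ {a b} → b ≋ [] → StronglyCoprime a b → DegreeBelow a 1
stronglyCoprime-zero⇒constant {a} b≋0 strong =
  strong {a} 1ℤ 1ℤ (λ ()) (λ ()) (∣-respʳ (≋-sym (⊛-identityˡ a)) ∣-refl) (∣-const-⊛-zero 1ℤ b≋0)

x-not-constant : ¬ DegreeBelow X 1
x-not-constant X-const with X-const 1 (s≤s z≤n)
... | ()

-- The constant a is nonzero, since otherwise x would be a common divisor.
bezout-zero : ∀ {a b} → b ≋ [] → StronglyCoprime a b → ConstantBezout a b
bezout-zero {a} {b} b≋0 strong with coeff a 0 ℤ.≟ 0ℤ
... | no a₀≢0 = record { u = const 1ℤ ; v = [] ; K = coeff a 0 ; K≢0 = a₀≢0
                       ; bezout = ⊕-identityʳ _ ⟫ ⊛-identityˡ a ⟫ constant-form (stronglyCoprime-zero⇒constant b≋0 strong) }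
... | yes a₀≡0 = ⊥-elim (x-not-constant (strong {X} 1ℤ 1ℤ (λ ()) (λ ()) (∣-const-⊛-zero 1ℤ a≋0) (∣-const-⊛-zero 1ℤ b≋0)))
  where
  a≋0 : a ≋ []
  a≋0 = constant-form (stronglyCoprime-zero⇒constant b≋0 strong) ⟫ const-≋ a₀≡0 ⟫ 0∷[]≋[]

stronglyCoprime-step : ∀ {a b n} (D : PseudoDivision a b n) → StronglyCoprime a b → StronglyCoprime b (PseudoDivision.rem D)
stronglyCoprime-step {a} {b} D strong {e} K₁ K₂ K₁≢0 K₂≢0 e∣K₁b e∣K₂r =
  strong {e} (K₁ ℤ.* K₂ ℤ.* K) K₁ (*-≢0 (*-≢0 K₁≢0 K₂≢0) factor≢0) K₁≢0
    (∣-respʳ combination (∣-⊕ (∣-⊛ˡ (const K₂ ⊛ q) e∣K₁b) (∣-⊛ˡ (const K₁) e∣K₂r)))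
    e∣K₁b
  where
  open PseudoDivision D renaming (factor to K; quot to q; rem to r; equation to Ka≋qb+r)
  rearrange : ∀ k₁ k₂ q b r → (k₂ ⊛ q) ⊛ (k₁ ⊛ b) ⊕ k₁ ⊛ (k₂ ⊛ r) ≋ (k₁ ⊛ k₂) ⊛ (q ⊛ b ⊕ r)
  rearrange = Solver.solve-∀ ℤ[x]-solver
  combination : (const K₂ ⊛ q) ⊛ (const K₁ ⊛ b) ⊕ const K₁ ⊛ (const K₂ ⊛ r) ≋ const (K₁ ℤ.* K₂ ℤ.* K) ⊛ a
  combination = rearrange (const K₁) (const K₂) q b r ⟫ ⊛-congʳ (const K₁ ⊛ const K₂) (≋-sym Ka≋qb+r)
    ⟫ ⊛-congˡ (const K ⊛ a) (const-⊛-const K₁ K₂) ⟫ const-⊛-const-⊛ (K₁ ℤ.* K₂) K a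

bezout-step : ∀ {a b n} (D : PseudoDivision a b n) → ConstantBezout b (PseudoDivision.rem D) → ConstantBezout a b
bezout-step {a} {b} D B = record
  { u = v ⊛ const K ; v = u ⊕ negate (v ⊛ q) ; K = K′ ; K≢0 = K≢0
  ; bezout = rearrange u v (const K) a q b
             ⟫ ⊕-cong (≋-refl {u ⊛ b}) (⊛-congʳ v (⊕-cong Ka≋qb+r (≋-refl {negate (q ⊛ b)}) ⟫ cancel q b r))
             ⟫ bezout }
  where
  open PseudoDivision D renaming (factor to K; quot to q; rem to r; equation to Ka≋qb+r)
  open ConstantBezout B renaming (K to K′)
  rearrange : ∀ u v k a q b → (v ⊛ k) ⊛ a ⊕ (u ⊕ negate (v ⊛ q)) ⊛ b ≋ u ⊛ b ⊕ v ⊛ (k ⊛ a ⊕ negate (q ⊛ b))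
  rearrange = Solver.solve-∀ ℤ[x]-solver
  cancel : ∀ q b r → (q ⊛ b ⊕ r) ⊕ negate (q ⊛ b) ≋ r
  cancel = Solver.solve-∀ ℤ[x]-solver

stronglyCoprime⇒bezout : ∀ N {a b} → DegreeBelow b N → StronglyCoprime a b → ConstantBezout a b
stronglyCoprime⇒bezout N {a} {b} b-below strong with zero-or-degree b
... | inj₁ b≋0 = bezout-zero b≋0 strong
... | inj₂ (n , deg-b) with N
...   | zero  = ⊥-elim (proj₂ deg-b (b-below n z≤n))
...   | suc N′ = bezout-step D
                   (stronglyCoprime⇒bezout N′ (DegreeBelow-mono {rem} n≤N′ rem-degree) (stronglyCoprime-step D strong))
  where
  D : PseudoDivision a b n
  D = pseudo-divide a {b} deg-b
  open PseudoDivision D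
  n≤N′ : n ≤ N′
  n≤N′ with n ℕ.≤? N′
  ... | yes n≤N′ = n≤N′
  ... | no  n≰N′ = ⊥-elim (proj₂ deg-b (b-below n (ℕP.≰⇒> n≰N′)))

prime-not-unit : ∀ {p} → Prime p → ¬ (const (+ p) ∣ const 1ℤ)
prime-not-unit {p} p-prime (divides r pr≋1) = ℕP.<⇒≢ (prime>1 p-prime) (sym (ℕD.∣1⇒≡1 (SD.∣⇒∣ᵤ p∣1)))
  where
  p∣1 : + p SD.∣ 1ℤ
  p∣1 = SD.divides (coeff r 0) (trans (sym (coeff-≡ pr≋1 0)) (trans (const-⊛-coeff (+ p) r 0) (ℤP.*-comm (+ p) (coeff r 0))))

∣-const-⊛-both : ∀ c {x y} → x ∣ y → const c ⊛ x ∣ const c ⊛ y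
∣-const-⊛-both c {x} (divides r xr≋y) = divides r (⊛-assoc (const c) x r ⟫ ⊛-congʳ (const c) xr≋y)

HasDegree-const-⊛⁻ : ∀ {p a a′ m} → Prime p → a ≋ const (+ p) ⊛ a′ → HasDegree a m →
  HasDegree a′ m × ℤ.∣ coeff a′ m ∣ < ℤ.∣ coeff a m ∣
HasDegree-const-⊛⁻ {p} {a} {a′} {m} p-prime a≋pa′ (a-below , lead≢0) = (a′-below , lead′≢0) , smaller
  where
  coeff-a : ∀ i → coeff a i ≡ + p ℤ.* coeff a′ i
  coeff-a i = trans (coeff-≡ a≋pa′ i) (const-⊛-coeff (+ p) a′ i)
  a′-below : DegreeBelow a′ (suc m)
  a′-below i m<i = *-cancelˡ (+ p) (prime≢0 p-prime)
                     (trans (sym (coeff-a i)) (trans (a-below i m<i) (sym (ℤP.*-zeroʳ (+ p)))))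
  lead′≢0 : coeff a′ m ≢ 0ℤ
  lead′≢0 lead′≡0 = lead≢0 (trans (coeff-a m) (trans (cong (+ p ℤ.*_) lead′≡0) (ℤP.*-zeroʳ (+ p))))
  smaller : ℤ.∣ coeff a′ m ∣ < ℤ.∣ coeff a m ∣
  smaller = subst (ℤ.∣ coeff a′ m ∣ <_)
                  (sym (trans (cong ℤ.∣_∣ (coeff-a m)) (trans (ℤP.abs-* (+ p) (coeff a′ m)) (ℕP.*-comm p _))))
                  (ℕP.m<m*n ℤ.∣ coeff a′ m ∣ p {{ℤ.≢-nonZero lead′≢0}} (prime>1 p-prime))

-- p cannot divide the content of b, as a and b are coprime.
content-divides : ∀ {p a a′ b h} → Prime p → Coprime a b → a ≋ const (+ p) ⊛ a′ → a ∣ b ⊛ h → DividesAllCoeffs p h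
content-divides {p} {a} {a′} {b} {h} p-prime cop a≋pa′ (divides r ar≋bh) =
  [ (λ p∣b → ⊥-elim (prime-not-unit p-prime (cop (divides a′ (≋-sym a≋pa′)) (DividesAllCoeffs⇒∣ b p∣b)))) , id ]′
  (gauss p-prime b h p∣bh)
  where
  p∣bh : DividesAllCoeffs p (b ⊛ h)
  p∣bh = DividesAllCoeffs-resp (≋-sym (⊛-assoc (const (+ p)) a′ r) ⟫ ⊛-congˡ r (≋-sym a≋pa′) ⟫ ar≋bh)
                               (DividesAllCoeffs-const-⊛ p (a′ ⊛ r))

-- Induction on a bound n for |K| + |lc a|: a prime factor of K is removed either from K or from a and h.
euclid-descent : ∀ {b} n {a h K m} → Coprime a b → K ≢ 0ℤ → HasDegree a m →
  ℤ.∣ K ∣ ℕ.+ ℤ.∣ coeff a m ∣ ≤ n → a ∣ b ⊛ h → a ∣ const K ⊛ h → a ∣ h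
euclid-descent zero {K = K} cop K≢0 deg-a bound _ _ =
  ⊥-elim (proj₂ deg-a (ℤP.∣i∣≡0⇒i≡0 (ℕP.m+n≡0⇒n≡0 ℤ.∣ K ∣ (ℕP.n≤0⇒n≡0 bound))))
euclid-descent {b} (suc n) {a} {h} {K} {m} cop K≢0 deg-a bound a∣bh a∣Kh with ℤ.∣ K ∣ ℕ.≟ 1
... | yes ∣K∣≡1 = ∣-cancel-unit K ∣K∣≡1 a∣Kh
... | no  ∣K∣≢1 = by-content (dividesAllCoeffs? p a)
  where
  open PrimeSplit (prime-split K K≢0 ∣K∣≢1)
  by-content : Dec (DividesAllCoeffs p a) → a ∣ h
  by-content (no p∤a) = euclid-descent n cop K′≢0 deg-a bound′ a∣bh
                          (∣-cancel-prime p-prime p∤a (∣-respʳ (const-⊛-split {p = p} K≡pK′ h) a∣Kh))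
    where
    bound′ : ℤ.∣ K′ ∣ ℕ.+ ℤ.∣ coeff a m ∣ ≤ n
    bound′ = ℕP.≤-pred (ℕP.<-≤-trans (ℕP.+-monoˡ-< ℤ.∣ coeff a m ∣ ∣K′∣<∣K∣) bound)
  by-content (yes p∣a) = remove-from-a (DividesAllCoeffs⇒factor a p∣a)
    where
    remove-from-a : ∃ (λ a′ → a ≋ const (+ p) ⊛ a′) → a ∣ h
    remove-from-a (a′ , a≋pa′) = remove-from-h (DividesAllCoeffs⇒factor h (content-divides p-prime cop a≋pa′ a∣bh))
      where
      deg-a′ : HasDegree a′ m × ℤ.∣ coeff a′ m ∣ < ℤ.∣ coeff a m ∣
      deg-a′ = HasDegree-const-⊛⁻ p-prime a≋pa′ deg-a
      bound′ : ℤ.∣ K ∣ ℕ.+ ℤ.∣ coeff a′ m ∣ ≤ n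
      bound′ = ℕP.≤-pred (ℕP.<-≤-trans (ℕP.+-monoʳ-< ℤ.∣ K ∣ (proj₂ deg-a′)) bound)
      remove-from-h : ∃ (λ h′ → h ≋ const (+ p) ⊛ h′) → a ∣ h
      remove-from-h (h′ , h≋ph′) = ∣-respˡ (≋-sym a≋pa′) (∣-respʳ (≋-sym h≋ph′) (∣-const-⊛-both (+ p) a′∣h′))
        where
        cancel : ∀ x → a ∣ x ⊛ h → a′ ∣ x ⊛ h′
        cancel x a∣xh = ∣-cancel-const (+ p) (prime≢0 p-prime)
                          (∣-respˡ a≋pa′ (∣-respʳ (⊛-congʳ x h≋ph′ ⟫ ⊛-const-⊛-comm x (+ p) h′) a∣xh))
        a′∣h′ : a′ ∣ h′
        a′∣h′ = euclid-descent n (coprime-∣ˡ (divides (const (+ p)) (⊛-comm a′ _ ⟫ ≋-sym a≋pa′)) cop)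
                  K≢0 (proj₁ deg-a′) bound′ (cancel b a∣bh) (cancel (const K) a∣Kh)

euclid : ∀ {a b h} → Coprime a b → a ∣ b ⊛ h → a ∣ h
euclid {a} {b} {h} cop a∣bh = by-degree (zero-or-degree a)
  where
  open ConstantBezout (stronglyCoprime⇒bezout (length b) (DegreeBelow-length b) (coprime⇒stronglyCoprime cop))
  expand : ∀ u v a b h → (u ⊛ h) ⊛ a ⊕ v ⊛ (b ⊛ h) ≋ (u ⊛ a ⊕ v ⊛ b) ⊛ h
  expand = Solver.solve-∀ ℤ[x]-solver
  a∣Kh : a ∣ const K ⊛ h
  a∣Kh = ∣-respʳ (expand u v a b h ⟫ ⊛-congˡ h bezout) (∣-⊕ (∣-⊛ˡ (u ⊛ h) ∣-refl) (∣-⊛ˡ v a∣bh))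
  by-degree : (a ≋ []) ⊎ (∃ λ m → HasDegree a m) → a ∣ h
  by-degree (inj₁ a≋0) = ∣-respʳ (≋-sym h≋0) ∣-zero
    where
    h≋0 : h ≋ []
    h≋0 = const-⊛-cancelˡ K K≢0 (≋-sym (quotient-≋ a∣Kh) ⟫ ⊛-zeroˡ a _ a≋0 ⟫ ≋-sym (⊛-zeroʳ (const K)))
  by-degree (inj₂ (m , deg-a)) = euclid-descent _ cop K≢0 deg-a ℕP.≤-refl a∣bh a∣Kh

-- Fibonacci-type sequences

module FibonacciSequence {p0 : ℤ} {p1 d g : Poly} (p0≡0 : p0 ≡ 0ℤ) (p1≈1 : p1 ≈ const 1ℤ) (d⊥g : Coprime d g) where

  G : ℕ → Poly
  G = GFP p0 p1 d g

  G₀ : G 0 ≋ []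
  G₀ = const-≋ p0≡0 ⟫ 0∷[]≋[]

  G₁ : G 1 ≋ const 1ℤ
  G₁ = coeffwise p1≈1

  G-addition : ∀ m n → G (suc (n ℕ.+ m)) ≋ G (suc m) ⊛ G (suc n) ⊕ g ⊛ (G m ⊛ G n)
  G-addition m zero = ≋-sym (⊕-cong (⊛-congʳ (G (suc m)) G₁) (⊛-congʳ g (⊛-congʳ (G m) G₀))
                             ⟫ identity-case (G (suc m)) (G m) g)
    where
    identity-case : ∀ A B g → A ⊛ const 1ℤ ⊕ g ⊛ (B ⊛ []) ≋ A
    identity-case = Solver.solve-∀ ℤ[x]-solver
  G-addition m (suc zero) =
    ≋-sym (⊕-cong (⊛-congʳ (G (suc m)) (⊕-cong (⊛-congʳ d G₁) (⊛-congʳ g G₀))) (⊛-congʳ g (⊛-congʳ (G m) G₁))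
           ⟫ base-case (G (suc m)) (G m) d g)
    where
    base-case : ∀ A B d g → A ⊛ (d ⊛ const 1ℤ ⊕ g ⊛ []) ⊕ g ⊛ (B ⊛ const 1ℤ) ≋ d ⊛ A ⊕ g ⊛ B
    base-case = Solver.solve-∀ ℤ[x]-solver
  G-addition m (suc (suc k)) = ⊕-cong (⊛-congʳ d (G-addition m (suc k))) (⊛-congʳ g (G-addition m k))
                               ⟫ step-case (G (suc m)) (G m) d g (G k) (G (suc k))
    where
    step-case : ∀ A B d g Gₖ Gₖ₊₁ →
      d ⊛ (A ⊛ (d ⊛ Gₖ₊₁ ⊕ g ⊛ Gₖ) ⊕ g ⊛ (B ⊛ Gₖ₊₁)) ⊕ g ⊛ (A ⊛ Gₖ₊₁ ⊕ g ⊛ (B ⊛ Gₖ))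
        ≋ A ⊛ (d ⊛ (d ⊛ Gₖ₊₁ ⊕ g ⊛ Gₖ) ⊕ g ⊛ Gₖ₊₁) ⊕ g ⊛ (B ⊛ (d ⊛ Gₖ₊₁ ⊕ g ⊛ Gₖ))
    step-case = Solver.solve-∀ ℤ[x]-solver

  G-addition′ : ∀ a b → G (a ℕ.+ suc b) ≋ G (suc a) ⊛ G (suc b) ⊕ g ⊛ (G a ⊛ G b)
  G-addition′ a b rewrite ℕP.+-suc a b | ℕP.+-comm a b = G-addition a b

  d^ : ℕ → Poly
  d^ zero    = const 1ℤ
  d^ (suc n) = d ⊛ d^ n

  G-mod-g : ℕ → Poly
  G-mod-g zero    = []
  G-mod-g (suc n) = d ⊛ G-mod-g n ⊕ G n

  G≡d^ : ∀ n → G (suc n) ≋ d^ n ⊕ g ⊛ G-mod-g n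
  G≡d^ zero    = G₁ ⟫ ≋-sym (⊕-cong (≋-refl {const 1ℤ}) (⊛-zeroʳ g) ⟫ ⊕-identityʳ (const 1ℤ))
  G≡d^ (suc n) = ⊕-cong (⊛-congʳ d (G≡d^ n)) (≋-refl {g ⊛ G n}) ⟫ regroup d g (d^ n) (G-mod-g n) (G n)
    where
    regroup : ∀ d g D s Gₙ → d ⊛ (D ⊕ g ⊛ s) ⊕ g ⊛ Gₙ ≋ d ⊛ D ⊕ g ⊛ (d ⊛ s ⊕ Gₙ)
    regroup = Solver.solve-∀ ℤ[x]-solver

  d^⊥g : ∀ n → Coprime (d^ n) g
  d^⊥g zero    c∣1 _   = c∣1
  d^⊥g (suc n) c∣dd^ c∣g = d^⊥g n (euclid (λ c′∣c c′∣d → d⊥g c′∣d (∣-trans c′∣c c∣g)) c∣dd^) c∣g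

  Gₙ⊥Gₙ₊₁ : ∀ n → Coprime (G n) (G (suc n))
  Gₙ⊥Gₙ₊₁ zero    _ c∣G₁ = ∣-respʳ G₁ c∣G₁
  Gₙ⊥Gₙ₊₁ (suc n) {c} c∣Gₙ₊₁ c∣Gₙ₊₂ = Gₙ⊥Gₙ₊₁ n (euclid c⊥g c∣gGₙ) c∣Gₙ₊₁
    where
    c⊥g : Coprime c g
    c⊥g e∣c e∣g = d^⊥g n (∣-⊕-cancelʳ (∣-respʳ (G≡d^ n) (∣-trans e∣c c∣Gₙ₊₁)) (∣-⊛ʳ (G-mod-g n) e∣g)) e∣g
    c∣gGₙ : c ∣ g ⊛ G n
    c∣gGₙ = ∣-⊕-cancelˡ c∣Gₙ₊₂ (∣-⊛ˡ d c∣Gₙ₊₁)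

  ∣-G-+ : ∀ {c} a b → c ∣ G a → c ∣ G b → c ∣ G (a ℕ.+ b)
  ∣-G-+ a zero    c∣Ga _    = subst (λ k → _ ∣ G k) (sym (ℕP.+-identityʳ a)) c∣Ga
  ∣-G-+ a (suc b) c∣Ga c∣Gb = ∣-respʳ (≋-sym (G-addition′ a b)) (∣-⊕ (∣-⊛ˡ (G (suc a)) c∣Gb) (∣-⊛ˡ g (∣-⊛ʳ (G b) c∣Ga)))

  ∣-G-∸ : ∀ {c} a b → c ∣ G a → c ∣ G (a ℕ.+ b) → c ∣ G b
  ∣-G-∸ a zero    _    _      = ∣-respʳ (≋-sym G₀) ∣-zero
  ∣-G-∸ a (suc b) c∣Ga c∣Ga+b = euclid (λ e∣c e∣Ga₊₁ → Gₙ⊥Gₙ₊₁ a (∣-trans e∣c c∣Ga) e∣Ga₊₁)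
    (∣-⊕-cancelʳ (∣-respʳ (G-addition′ a b) c∣Ga+b) (∣-⊛ˡ g (∣-⊛ʳ (G b) c∣Ga)))

  ∣-G-* : ∀ {c} a j → c ∣ G a → c ∣ G (j ℕ.* a)
  ∣-G-* a zero    _    = ∣-respʳ (≋-sym G₀) ∣-zero
  ∣-G-* a (suc j) c∣Ga = ∣-G-+ a (j ℕ.* a) c∣Ga (∣-G-* a j c∣Ga)

  G-∣ : ∀ {k m} → k ℕD.∣ m → G k ∣ G m
  G-∣ {k} (ℕD.divides q refl) = ∣-G-* k q ∣-refl

  ∣-G-gcd : ∀ {c} m n → c ∣ G m → c ∣ G n → c ∣ G (gcd m n)
  ∣-G-gcd {c} m n c∣Gm c∣Gn with Bézout.identity (gcd-GCD m n)
  ... | Bézout.+- x y eq = ∣-G-∸ (y ℕ.* n) (gcd m n) (∣-G-* n y c∣Gn)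
                             (subst (λ k → c ∣ G k) (trans (sym eq) (ℕP.+-comm (gcd m n) (y ℕ.* n))) (∣-G-* m x c∣Gm))
  ... | Bézout.-+ x y eq = ∣-G-∸ (x ℕ.* m) (gcd m n) (∣-G-* m x c∣Gm)
                             (subst (λ k → c ∣ G k) (trans (sym eq) (ℕP.+-comm (gcd m n) (x ℕ.* m))) (∣-G-* n y c∣Gn))

  G-gcd : ∀ m n → IsGCD (G m) (G n) (G (gcd m n))
  G-gcd m n = ∣⇒∣ₚ (G-∣ (gcd[m,n]∣m m n)) , ∣⇒∣ₚ (G-∣ (gcd[m,n]∣n m n))
            , λ c c∣Gm c∣Gn → ∣⇒∣ₚ (∣-G-gcd m n (∣ₚ⇒∣ {c} c∣Gm) (∣ₚ⇒∣ {c} c∣Gn))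

-- Lucas-type sequences

coeff₀-⊛ : ∀ p q → coeff (p ⊛ q) 0 ≡ coeff p 0 ℤ.* coeff q 0
coeff₀-⊛ []      q = sym (ℤP.*-zeroˡ (coeff q 0))
coeff₀-⊛ (a ∷ p) q = trans (coeff-∷-⊛ a p q 0) (ℤP.+-identityʳ _)

∣-const⇒∣coeff₀ : ∀ {x k} → x ∣ const k → ℤ.∣ coeff x 0 ∣ ℕD.∣ ℤ.∣ k ∣
∣-const⇒∣coeff₀ {x} {k} (divides r xr≋k) = ℕD.divides ℤ.∣ coeff r 0 ∣ (begin
  ℤ.∣ k ∣                                 ≡⟨ cong ℤ.∣_∣ (trans (sym (coeff-≡ xr≋k 0)) (coeff₀-⊛ x r)) ⟩
  ℤ.∣ coeff x 0 ℤ.* coeff r 0 ∣           ≡⟨ ℤP.abs-* (coeff x 0) (coeff r 0) ⟩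
  ℤ.∣ coeff x 0 ∣ ℕ.* ℤ.∣ coeff r 0 ∣     ≡⟨ ℕP.*-comm ℤ.∣ coeff x 0 ∣ _ ⟩
  ℤ.∣ coeff r 0 ∣ ℕ.* ℤ.∣ coeff x 0 ∣     ∎)
  where open ≡-Reasoning

unit-form : ∀ {u} → u ∣ const 1ℤ → (u ≋ const (coeff u 0)) × (ℤ.∣ coeff u 0 ∣ ≡ 1)
unit-form u∣1 = constant-form (unit⇒constant u∣1) , ℕD.∣1⇒≡1 (∣-const⇒∣coeff₀ u∣1)

const-square : ∀ c → ℤ.∣ c ∣ ≡ 1 → const c ⊛ const c ≋ const 1ℤ
const-square c ∣c∣≡1 = const-⊛-const c c ⟫ const-≋ (abs≡1⇒square≡1 c ∣c∣≡1)

unit-square : ∀ {u} → u ∣ const 1ℤ → u ⊛ u ≋ const 1ℤ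
unit-square {u} u∣1 with unit-form u∣1
... | u≋c , ∣c∣≡1 = ⊛-cong u≋c u≋c ⟫ const-square (coeff u 0) ∣c∣≡1

eval-0 : ∀ p → eval p 0ℤ ≡ coeff p 0
eval-0 []      = refl
eval-0 (a ∷ p) = trans (cong (ℤ._+_ a) (ℤP.*-zeroˡ (eval p 0ℤ))) (ℤP.+-identityʳ a)

0≮-[_] : ∀ k → ¬ (0ℤ ℤ.< - (+ k))
0≮-[ k ] 0<-k = ℤP.<-irrefl refl (ℤP.<-≤-trans 0<-k (ℤP.neg-≤-pos {k} {0}))

x≡0-of-∣1+2x∣≡1 : ∀ x → 0ℤ ℤ.< 1ℤ ℤ.+ + 4 ℤ.* x → ℤ.∣ 1ℤ ℤ.+ + 2 ℤ.* x ∣ ≡ 1 → x ≡ 0ℤ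
x≡0-of-∣1+2x∣≡1 (+ 0)     _   _  = refl
x≡0-of-∣1+2x∣≡1 +[1+ n ]  _   ()
x≡0-of-∣1+2x∣≡1 -[1+ n ] 0<1+4x _ = ⊥-elim (0≮-[ 3 ℕ.+ 4 ℕ.* n ] (subst (0ℤ ℤ.<_) (trans (negative (+ n)) (cong -_ (sym
  (trans (ℤP.pos-+ 3 (4 ℕ.* n)) (cong (ℤ._+_ (+ 3)) (ℤP.pos-* 4 n)))))) 0<1+4x))
  where
  negative : ∀ m → 1ℤ ℤ.+ + 4 ℤ.* (- (1ℤ ℤ.+ m)) ≡ - (+ 3 ℤ.+ + 4 ℤ.* m)
  negative = ℤ-Solver.solve-∀

x≡2-of-∣2+x∣∣4 : ∀ x → 0ℤ ℤ.< + 4 ℤ.+ + 4 ℤ.* x → x ≢ 0ℤ → ℤ.∣ + 2 ℤ.+ x ∣ ℕD.∣ 4 → x ≡ + 2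
x≡2-of-∣2+x∣∣4 (+ 0)                 _ x≢0 _   = ⊥-elim (x≢0 refl)
x≡2-of-∣2+x∣∣4 +[1+ 0 ]              _ _   (ℕD.divides 0 ())
x≡2-of-∣2+x∣∣4 +[1+ 0 ]              _ _   (ℕD.divides 1 ())
x≡2-of-∣2+x∣∣4 +[1+ 0 ]              _ _   (ℕD.divides (suc (suc q)) ())
x≡2-of-∣2+x∣∣4 +[1+ 1 ]              _ _   _   = refl
x≡2-of-∣2+x∣∣4 +[1+ suc (suc k) ]    _ _   k∣4 with ℕD.∣⇒≤ k∣4
... | s≤s (s≤s (s≤s (s≤s ())))
x≡2-of-∣2+x∣∣4 -[1+ n ] 0<4+4x _ _ =
  ⊥-elim (0≮-[ 4 ℕ.* n ] (subst (0ℤ ℤ.<_) (trans (negative (+ n)) (cong -_ (sym (ℤP.pos-* 4 n)))) 0<4+4x))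
  where
  negative : ∀ m → + 4 ℤ.+ + 4 ℤ.* (- (1ℤ ℤ.+ m)) ≡ - (+ 4 ℤ.* m)
  negative = ℤ-Solver.solve-∀

∣x∣≡2⇒x≡2s : ∀ x → ℤ.∣ x ∣ ≡ 2 → ∃ λ s → (x ≡ + 2 ℤ.* s) × (ℤ.∣ s ∣ ≡ 1)
∣x∣≡2⇒x≡2s (+ 2)     refl = 1ℤ , refl , refl
∣x∣≡2⇒x≡2s -[1+ 1 ] refl = - 1ℤ , refl , refl

module LucasSequence {p0 : ℤ} {p1 d g : Poly} (gfp : GFPData p0 p1 d g) (lucas : LucasType p0 p1 d g)
  (G₁∣G₂ : GFP p0 p1 d g 1 ∣ GFP p0 p1 d g 2) (G₂∣G₄ : GFP p0 p1 d g 2 ∣ GFP p0 p1 d g 4) where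

  open GFPData gfp
  p0≢0 : p0 ≢ 0ℤ
  p0≢0 = proj₁ lucas
  2p1≈p0d : scale (+ 2) p1 ≈ scale p0 d
  2p1≈p0d = proj₁ (proj₂ lucas)
  ∣p0∣∈1,2 : (ℤ.∣ p0 ∣ ≡ 1) ⊎ (ℤ.∣ p0 ∣ ≡ 2)
  ∣p0∣∈1,2 = proj₁ (proj₂ (proj₂ lucas))
  p0⊥d : Coprime (const p0) d
  p0⊥d = coprimeP⇒coprime (proj₁ (proj₂ (proj₂ (proj₂ (proj₂ lucas)))))
  d⊥g : Coprime d g
  d⊥g = coprimeP⇒coprime coprime

  P₀ two G₂ : Poly
  P₀  = const p0
  two = const (+ 2)
  G₂  = GFP p0 p1 d g 2

  p1∣gP₀ : p1 ∣ g ⊛ P₀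
  p1∣gP₀ = ∣-⊕-cancelˡ G₁∣G₂ (∣-⊛ˡ d ∣-refl)

  G₂∣dgp1 : G₂ ∣ d ⊛ g ⊛ p1
  G₂∣dgp1 = ∣-⊕-cancelʳ (∣-respʳ (G₄-expansion d g G₂ p1) G₂∣G₄) (∣-⊛ˡ (d ⊛ d ⊕ g) ∣-refl)
    where
    G₄-expansion : ∀ d g G₂ p1 → d ⊛ (d ⊛ G₂ ⊕ g ⊛ p1) ⊕ g ⊛ G₂ ≋ d ⊛ g ⊛ p1 ⊕ (d ⊛ d ⊕ g) ⊛ G₂
    G₄-expansion = Solver.solve-∀ ℤ[x]-solver

  two⊛p1 : two ⊛ p1 ≋ P₀ ⊛ d
  two⊛p1 = const-⊛ (+ 2) p1 ⟫ coeffwise 2p1≈p0d ⟫ ≋-sym (const-⊛ p0 d)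

  discriminant₀ : 0ℤ ℤ.< coeff (d ⊛ d) 0 ℤ.+ + 4 ℤ.* coeff g 0
  discriminant₀ = subst (0ℤ ℤ.<_)
    (trans (eval-0 (d ⊛ d ⊕ scale (+ 4) g))
           (trans (coeff-⊕ (d ⊛ d) (scale (+ 4) g) 0) (cong (ℤ._+_ (coeff (d ⊛ d) 0)) (coeff-scale (+ 4) g 0))))
    (discr>0 0ℤ)

  coeff-G₂ : ∀ i → coeff G₂ i ≡ coeff (d ⊛ p1) i ℤ.+ p0 ℤ.* coeff g i
  coeff-G₂ i = trans (coeff-⊕ (d ⊛ p1) (g ⊛ P₀) i)
                     (cong (ℤ._+_ (coeff (d ⊛ p1) i)) (trans (coeff-≡ (⊛-const g p0) i) (coeff-scale p0 g i)))

  g-constant : ∀ {c} → d ⊛ p1 ≋ const c → DegreeBelow G₂ 1 → DegreeBelow g 1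
  g-constant dp1≋c G₂-const (suc i) _ = *-cancelˡ p0 p0≢0 (begin
    p0 ℤ.* coeff g (suc i)                              ≡⟨ ℤP.+-identityˡ _ ⟨
    0ℤ ℤ.+ p0 ℤ.* coeff g (suc i)                       ≡⟨ cong (ℤ._+ p0 ℤ.* coeff g (suc i)) (coeff-≡ dp1≋c (suc i)) ⟨
    coeff (d ⊛ p1) (suc i) ℤ.+ p0 ℤ.* coeff g (suc i)   ≡⟨ coeff-G₂ (suc i) ⟨
    coeff G₂ (suc i)                                    ≡⟨ G₂-const (suc i) (s≤s z≤n) ⟩
    0ℤ                                                  ≡⟨ ℤP.*-zeroʳ p0 ⟨
    p0 ℤ.* 0ℤ                                           ∎)
    where open ≡-Reasoning

  g₀≢0 : DegreeBelow g 1 → coeff g 0 ≢ 0ℤ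
  g₀≢0 g-const g₀≡0 with g≢0
  ... | zero  , g₀≢0  = g₀≢0 g₀≡0
  ... | suc i , gᵢ≢0 = gᵢ≢0 (g-const (suc i) (s≤s z≤n))

  -- With p0 = 2s, d divides p1 = s·d and hence g, so d = ±1; then G₂ divides g and s, so G₂ = s(1 + 2g) = ±1,
  -- and the discriminant 1 + 4g > 0 forces g = 0.
  impossible-∣p0∣≡2 : ∀ s → p0 ≡ + 2 ℤ.* s → ℤ.∣ s ∣ ≡ 1 → ⊥
  impossible-∣p0∣≡2 s p0≡2s ∣s∣≡1 = g₀≢0 g-const (x≡0-of-∣1+2x∣≡1 (coeff g 0) discriminant ∣1+2g₀∣≡1)
    where
    S : Poly
    S = const s
    P₀≋2S : P₀ ≋ two ⊛ S
    P₀≋2S = const-≋ p0≡2s ⟫ ≋-sym (const-⊛-const (+ 2) s)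
    p1≋Sd : p1 ≋ S ⊛ d
    p1≋Sd = const-⊛-cancelˡ (+ 2) (λ ()) (two⊛p1 ⟫ ⊛-congˡ d P₀≋2S ⟫ ⊛-assoc two S d)
    2∤d : ¬ DividesAllCoeffs 2 d
    2∤d 2∣d = prime-not-unit prime[2] (p0⊥d (divides S (≋-sym P₀≋2S)) (DividesAllCoeffs⇒∣ d 2∣d))
    rearrange : ∀ g T S → g ⊛ (T ⊛ S) ≋ T ⊛ (S ⊛ g)
    rearrange = Solver.solve-∀ ℤ[x]-solver
    d∣g : d ∣ g
    d∣g = ∣-cancel-unit s ∣s∣≡1 (∣-cancel-prime prime[2] 2∤d
            (∣-respʳ (⊛-congʳ g P₀≋2S ⟫ rearrange g two S) (∣-trans (divides S (⊛-comm d S ⟫ ≋-sym p1≋Sd)) p1∣gP₀)))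
    d-unit : d ∣ const 1ℤ
    d-unit = d⊥g ∣-refl d∣g
    swap : ∀ d S → d ⊛ (S ⊛ d) ≋ S ⊛ (d ⊛ d)
    swap = Solver.solve-∀ ℤ[x]-solver
    dp1≋S : d ⊛ p1 ≋ S
    dp1≋S = ⊛-congʳ d p1≋Sd ⟫ swap d S ⟫ ⊛-congʳ S (unit-square d-unit) ⟫ ⊛-identityʳ S
    regroup : ∀ d g p1 → d ⊛ g ⊛ p1 ≋ g ⊛ (d ⊛ p1)
    regroup = Solver.solve-∀ ℤ[x]-solver
    G₂∣g : G₂ ∣ g
    G₂∣g = ∣-cancel-unit s ∣s∣≡1 (∣-respʳ (regroup d g p1 ⟫ ⊛-congʳ g dp1≋S ⟫ ⊛-comm g S) G₂∣dgp1)
    G₂-unit : G₂ ∣ const 1ℤ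
    G₂-unit = ∣-cancel-unit s ∣s∣≡1 (∣-respʳ (dp1≋S ⟫ ≋-sym (⊛-identityʳ S)) (∣-⊕-cancelʳ ∣-refl (∣-⊛ʳ P₀ G₂∣g)))
    g-const : DegreeBelow g 1
    g-const = g-constant dp1≋S (unit⇒constant G₂-unit)
    factor : ∀ s g → s ℤ.+ (+ 2 ℤ.* s) ℤ.* g ≡ s ℤ.* (1ℤ ℤ.+ + 2 ℤ.* g)
    factor = ℤ-Solver.solve-∀
    ∣1+2g₀∣≡1 : ℤ.∣ 1ℤ ℤ.+ + 2 ℤ.* coeff g 0 ∣ ≡ 1
    ∣1+2g₀∣≡1 = begin
      ℤ.∣ 1ℤ ℤ.+ + 2 ℤ.* coeff g 0 ∣                   ≡⟨ ℕP.*-identityˡ _ ⟨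
      1 ℕ.* ℤ.∣ 1ℤ ℤ.+ + 2 ℤ.* coeff g 0 ∣             ≡⟨ cong (ℕ._* _) ∣s∣≡1 ⟨
      ℤ.∣ s ∣ ℕ.* ℤ.∣ 1ℤ ℤ.+ + 2 ℤ.* coeff g 0 ∣       ≡⟨ ℤP.abs-* s _ ⟨
      ℤ.∣ s ℤ.* (1ℤ ℤ.+ + 2 ℤ.* coeff g 0) ∣           ≡⟨ cong ℤ.∣_∣ (trans (cong₂ (λ c p → c ℤ.+ p ℤ.* coeff g 0) (coeff-≡ dp1≋S 0) p0≡2s)
                                                                            (factor s (coeff g 0))) ⟨
      ℤ.∣ coeff (d ⊛ p1) 0 ℤ.+ p0 ℤ.* coeff g 0 ∣      ≡⟨ cong ℤ.∣_∣ (coeff-G₂ 0) ⟨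
      ℤ.∣ coeff G₂ 0 ∣                                 ≡⟨ proj₂ (unit-form G₂-unit) ⟩
      1                                                ∎
      where open ≡-Reasoning
    discriminant : 0ℤ ℤ.< 1ℤ ℤ.+ + 4 ℤ.* coeff g 0
    discriminant = subst (λ c → 0ℤ ℤ.< c ℤ.+ + 4 ℤ.* coeff g 0) (coeff-≡ (unit-square d-unit) 0) discriminant₀

  -- With p0 = ±1, p1 divides d = 2·p0·p1 and g, so p1 = ±1; then G₂ = p0(2 + g) divides 4, forcing g = 2,
  -- and 2 divides both d and g.
  impossible-∣p0∣≡1 : ℤ.∣ p0 ∣ ≡ 1 → ⊥
  impossible-∣p0∣≡1 ∣p0∣≡1 = prime-not-unit prime[2] (d⊥g 2∣d 2∣g)
    where
    d≋P₀2p1 : d ≋ P₀ ⊛ (two ⊛ p1)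
    d≋P₀2p1 = ≋-sym (⊛-congʳ P₀ two⊛p1 ⟫ ≋-sym (⊛-assoc P₀ P₀ d) ⟫ ⊛-congˡ d (const-square p0 ∣p0∣≡1) ⟫ ⊛-identityˡ d)
    rearrange : ∀ x y z → x ⊛ (y ⊛ z) ≋ y ⊛ (x ⊛ z)
    rearrange = Solver.solve-∀ ℤ[x]-solver
    p1-unit : p1 ∣ const 1ℤ
    p1-unit = d⊥g (divides (P₀ ⊛ two) (rearrange p1 P₀ two ⟫ ⊛-congʳ P₀ (⊛-comm p1 two) ⟫ ≋-sym d≋P₀2p1))
                  (∣-cancel-unit p0 ∣p0∣≡1 (∣-respʳ (⊛-comm g P₀) p1∣gP₀))
    regroup : ∀ P T p → (P ⊛ (T ⊛ p)) ⊛ p ≋ (P ⊛ T) ⊛ (p ⊛ p)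
    regroup = Solver.solve-∀ ℤ[x]-solver
    dp1≋P₀2 : d ⊛ p1 ≋ P₀ ⊛ two
    dp1≋P₀2 = ⊛-congˡ p1 d≋P₀2p1 ⟫ regroup P₀ two p1 ⟫ ⊛-congʳ (P₀ ⊛ two) (unit-square p1-unit) ⟫ ⊛-identityʳ _
    G₂-expansion : ∀ P T g → T ⊛ (P ⊛ T ⊕ g ⊛ P) ≋ P ⊛ (T ⊛ T) ⊕ g ⊛ (P ⊛ T)
    G₂-expansion = Solver.solve-∀ ℤ[x]-solver
    dgp1 : ∀ d g p1 → d ⊛ g ⊛ p1 ≋ g ⊛ (d ⊛ p1)
    dgp1 = Solver.solve-∀ ℤ[x]-solver
    G₂∣4 : G₂ ∣ const (+ 4)
    G₂∣4 = ∣-cancel-unit p0 ∣p0∣≡1 (∣-respʳ (⊛-congʳ P₀ (const-⊛-const (+ 2) (+ 2)))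
             (∣-⊕-cancelʳ (∣-respʳ (⊛-congʳ two (⊕-cong dp1≋P₀2 (≋-refl {g ⊛ P₀})) ⟫ G₂-expansion P₀ two g)
                                   (∣-⊛ˡ two ∣-refl))
                          (∣-respʳ (dgp1 d g p1 ⟫ ⊛-congʳ g dp1≋P₀2) G₂∣dgp1)))
    g-const : DegreeBelow g 1
    g-const = g-constant (dp1≋P₀2 ⟫ const-⊛-const p0 (+ 2)) (∣-const⇒constant G₂∣4 λ ())
    factor : ∀ p g → p ℤ.* + 2 ℤ.+ p ℤ.* g ≡ p ℤ.* (+ 2 ℤ.+ g)
    factor = ℤ-Solver.solve-∀
    ∣2+g₀∣∣4 : ℤ.∣ + 2 ℤ.+ coeff g 0 ∣ ℕD.∣ 4
    ∣2+g₀∣∣4 = subst (ℕD._∣ 4) ∣G₂₀∣≡∣2+g₀∣ (∣-const⇒∣coeff₀ G₂∣4)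
      where
      ∣G₂₀∣≡∣2+g₀∣ : ℤ.∣ coeff G₂ 0 ∣ ≡ ℤ.∣ + 2 ℤ.+ coeff g 0 ∣
      ∣G₂₀∣≡∣2+g₀∣ = begin
        ℤ.∣ coeff G₂ 0 ∣                                ≡⟨ cong ℤ.∣_∣ (trans (coeff-G₂ 0) (cong (ℤ._+ p0 ℤ.* coeff g 0)
                                                             (trans (coeff-≡ dp1≋P₀2 0) (coeff₀-⊛ P₀ two)))) ⟩
        ℤ.∣ p0 ℤ.* + 2 ℤ.+ p0 ℤ.* coeff g 0 ∣           ≡⟨ cong ℤ.∣_∣ (factor p0 (coeff g 0)) ⟩
        ℤ.∣ p0 ℤ.* (+ 2 ℤ.+ coeff g 0) ∣                ≡⟨ ℤP.abs-* p0 _ ⟩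
        ℤ.∣ p0 ∣ ℕ.* ℤ.∣ + 2 ℤ.+ coeff g 0 ∣            ≡⟨ cong (ℕ._* _) ∣p0∣≡1 ⟩
        1 ℕ.* ℤ.∣ + 2 ℤ.+ coeff g 0 ∣                   ≡⟨ ℕP.*-identityˡ _ ⟩
        ℤ.∣ + 2 ℤ.+ coeff g 0 ∣                         ∎
        where open ≡-Reasoning
    dd≋4 : ∀ P T p → (P ⊛ (T ⊛ p)) ⊛ (P ⊛ (T ⊛ p)) ≋ (P ⊛ P) ⊛ ((T ⊛ T) ⊛ (p ⊛ p))
    dd≋4 = Solver.solve-∀ ℤ[x]-solver
    d²≋4 : d ⊛ d ≋ const (+ 4)
    d²≋4 = ⊛-cong d≋P₀2p1 d≋P₀2p1 ⟫ dd≋4 P₀ two p1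
           ⟫ ⊛-cong (const-square p0 ∣p0∣≡1) (⊛-cong (const-⊛-const (+ 2) (+ 2)) (unit-square p1-unit))
           ⟫ ⊛-identityˡ _ ⟫ ⊛-identityʳ (const (+ 4))
    discriminant : 0ℤ ℤ.< + 4 ℤ.+ + 4 ℤ.* coeff g 0
    discriminant = subst (λ c → 0ℤ ℤ.< c ℤ.+ + 4 ℤ.* coeff g 0) (coeff-≡ d²≋4 0) discriminant₀
    g≋2 : g ≋ two
    g≋2 = constant-form g-const ⟫ const-≋ (x≡2-of-∣2+x∣∣4 (coeff g 0) discriminant (g₀≢0 g-const) ∣2+g₀∣∣4)
    2∣g : two ∣ g
    2∣g = divides (const 1ℤ) (⊛-identityʳ two ⟫ ≋-sym g≋2)
    2∣d : two ∣ d
    2∣d = divides (P₀ ⊛ p1) (rearrange two P₀ p1 ⟫ ≋-sym d≋P₀2p1)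

  impossible : ⊥
  impossible with ∣p0∣∈1,2
  ... | inj₁ ∣p0∣≡1 = impossible-∣p0∣≡1 ∣p0∣≡1
  ... | inj₂ ∣p0∣≡2 with ∣x∣≡2⇒x≡2s p0 ∣p0∣≡2
  ...   | s , p0≡2s , ∣s∣≡1 = impossible-∣p0∣≡2 s p0≡2s ∣s∣≡1

theorem19 : (p0 : ℤ) (p1 d g : Poly) → GFPData p0 p1 d g →
    FibonacciType p0 p1 d g ⊎ LucasType p0 p1 d g →
    ((∀ (m n : ℕ) → 0 < m → 0 < n →
        IsGCD (GFP p0 p1 d g m) (GFP p0 p1 d g n) (GFP p0 p1 d g (gcd m n)))
      → FibonacciType p0 p1 d g)
    × (FibonacciType p0 p1 d g →
      ∀ (m n : ℕ) → 0 < m → 0 < n →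
        IsGCD (GFP p0 p1 d g m) (GFP p0 p1 d g n) (GFP p0 p1 d g (gcd m n)))
theorem19 p0 p1 d g gfp type = gcd-property⇒fibonacci type , fibonacci⇒gcd-property
  where
  G : ℕ → Poly
  G = GFP p0 p1 d g
  GcdProperty : Set
  GcdProperty = ∀ (m n : ℕ) → 0 < m → 0 < n → IsGCD (G m) (G n) (G (gcd m n))
  fibonacci⇒gcd-property : FibonacciType p0 p1 d g → GcdProperty
  fibonacci⇒gcd-property (p0≡0 , p1≈1) m n _ _ =
    FibonacciSequence.G-gcd p0≡0 p1≈1 (coprimeP⇒coprime (GFPData.coprime gfp)) m n
  gcd-property⇒fibonacci : FibonacciType p0 p1 d g ⊎ LucasType p0 p1 d g → GcdProperty → FibonacciType p0 p1 d g
  gcd-property⇒fibonacci (inj₁ fibonacci) _        = fibonacci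
  gcd-property⇒fibonacci (inj₂ lucas)     gcd-prop = ⊥-elim (LucasSequence.impossible gfp lucas G₁∣G₂ G₂∣G₄)
    where
    G₁∣G₂ : G 1 ∣ G 2
    G₁∣G₂ = ∣ₚ⇒∣ (proj₁ (proj₂ (gcd-prop 1 2 (s≤s z≤n) (s≤s z≤n))))
    G₂∣G₄ : G 2 ∣ G 4
    G₂∣G₄ = ∣ₚ⇒∣ (proj₁ (proj₂ (gcd-prop 2 4 (s≤s z≤n) (s≤s z≤n))))
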